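{- Let $\mathbf{g}\in E$ and $\tau,\sigma\in\mathcal{U}_{\mathbf{g},\mathbf{g}}$. Then $B_{\mathbf{g},\mathbf{g},\tau}B_{\mathbf{g},\mathbf{g},\sigma}=\overline{k_{\tau\cap\sigma}}\,B_{\mathbf{g},\mathbf{g},\tau\cup\sigma}$, and $E^*_{\mathbf{g}}\mathbb{T}E^*_{\mathbf{g}}$ is a commutative $\mathbb{F}$-subalgebra of $\mathbb{T}$ with $\mathbb{F}$-basis $\{B_{\mathbf{g},\mathbf{g},\alpha}:\alpha\in\mathcal{U}_{\mathbf{g},\mathbf{g}}\}$.
   Context: Let $\mathbb{F}$ be a field; for an integer $a$ let $\overline{a}$ be its image in $\mathbb{F}$. Fix $n\ge1$ and integers $\ell_1,\dots,\ell_n,m_1,\dots,m_n\ge2$. For each $i\in\{1,\dots,n\}$ let $U_i$ be a set with $|U_i|=\ell_im_i$ partitioned into $\ell_i$ blocks of size $m_i$, with relations $R^i_0=\{(a,a)\}$, $R^i_1=\{(a,b):a\ne b\text{ in the same block}\}$, $R^i_2=\{(a,b):a,b\text{ in different blocks}\}$. Let $X=\prod_iU_i$, $E$ the set of $n$-tuples with entries in $\{0,1,2\}$, $R_{\mathbf{g}}=\{(\mathbf{a},\mathbf{b}):(\mathbf{a}_i,\mathbf{b}_i)\in R^i_{\mathbf{g}_i}\ \forall i\}$. For $\mathbf{g}\in E$, $j\in\{0,1,2\}$ put $S_j(\mathbf{g})=\{a:\mathbf{g}_a=j\}$; for $V\subseteq\{1,\dots,n\}$ put $V^\bullet=\{a\in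 V:\ell_a>2\}$, $V^\circ=\{a\in V:m_a>2\}$. Fix $\mathbf{x}\in X$; $A_{\mathbf{g}}\in\mathrm{M}_X(\mathbb{F})$ is the $0/1$ adjacency matrix of $R_{\mathbf{g}}$, $E^*_{\mathbf{g}}$ the diagonal matrix with $(\mathbf{y},\mathbf{y})$-entry $\overline1$ iff $(\mathbf{x},\mathbf{y})\in R_{\mathbf{g}}$, $\mathbb{T}$ the $\mathbb{F}$-subalgebra of $\mathrm{M}_X(\mathbb{F})$ generated by all $A_{\mathbf{g}},E^*_{\mathbf{g}}$, and $E^*_{\mathbf{g}}\mathbb{T}E^*_{\mathbf{g}}=\{E^*_{\mathbf{g}}ME^*_{\mathbf{g}}:M\in\mathbb{T}\}$; $O$ is the zero matrix. For triples $\tau=(J_1,J_2,J_3)$, $\sigma=(K_1,K_2,K_3)$ of subsets: $\tau\cap\sigma$ and $\tau\cup\sigma$ are taken componentwise, and $k_\tau=\prod_{j\in J_1}(m_j-1)\prod_{j\in J_2}(\ell_j-1)m_j\prod_{j\in J_3\setminus J_2}m_j$ (empty products $=1$). For $\mathbf{g},\mathbf{h}\in E$, $\mathcal{U}_{\mathbf{g},\mathbf{h}}$ is the set of triples $(J_1,J_2,J_3)$ with $J_1\subseteq(S_1(\mathbf{g})\cap S_1(\mathbf{h}))^\circ$, $J_2\subseteq(S_2(\mathbf{g})\cap S_2(\mathbf{h}))^\bullet$, $J_2\subseteq J_3\subseteq S_2(\mathbf{g})\cap S_2(\mathbf{h})$. For $\tau=(J_1,J_2,J_3)\in\mathcal{U}_{\mathbf{g},\mathbf{h}}$,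 $B_{\mathbf{g},\mathbf{h},\tau}=\sum E^*_{\mathbf{g}}A_{\mathbf{a}}E^*_{\mathbf{h}}$ over all $\mathbf{a}\in E$ with $E^*_{\mathbf{g}}A_{\mathbf{a}}E^*_{\mathbf{h}}\ne O$, $S_1(\mathbf{a})\cap(S_1(\mathbf{g})\cap S_1(\mathbf{h}))^\circ\subseteq J_1$, $S_2(\mathbf{a})\cap(S_2(\mathbf{g})\cap S_2(\mathbf{h}))^\bullet\subseteq J_2$, $S_1(\mathbf{a})\cap S_2(\mathbf{g})\cap S_2(\mathbf{h})\subseteq J_3$. -}

module Defs where

open import Level using (Level; _⊔_) renaming (suc to lsuc)
open import Algebra.Bundles using (CommutativeRing)
open import Data.Nat as ℕ using (ℕ; zero; suc; _∸_; _<?_)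
open import Data.Bool using (Bool; true; false; if_then_else_; _∧_)
open import Data.Fin as Fin using (Fin; zero; suc)
open import Data.Fin.Properties using (all?) renaming (_≟_ to _≟F_)
open import Data.Fin.Subset using (Subset; _∈_; _⊆_; _∩_; _∪_)
open import Data.Fin.Subset.Properties using (_⊆?_; _∈?_)
open import Data.Vec as Vec using (Vec; []; _∷_; tabulate; lookup)
open import Data.List as List using (List; []; _∷_; [_]; foldr; map; concatMap; allFin; filter; cartesianProduct)
open import Data.Product using (Σ; ∃; _×_; _,_)
open import Data.Product.Properties using (≡-dec)
open import Relation.Nullary using (¬_; Dec; yes; no; does)
open import Relation.Nullary.Decidable using (⌊_⌋; _×-dec_)
open import Relation.Binary.PropositionalEquality using (_≡_)

record Field (c ℓ : Level) : Set (lsuc (c ⊔ ℓ)) where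
  field
    commutativeRing : CommutativeRing c ℓ
  open CommutativeRing commutativeRing public
  field
    1≉0     : ¬ (1# ≈ 0#)
    inverse : ∀ x → ¬ (x ≈ 0#) → ∃ λ y → x * y ≈ 1#

allDep : ∀ {a} (n : ℕ) (A : Fin n → Set a) → (∀ i → List (A i)) → List ((i : Fin n) → A i)
allDep zero    A en = [ (λ ()) ]
allDep (suc n) A en =
  concatMap (λ a → map (λ f → λ { zero → a ; (suc i) → f i })
                       (allDep n (λ i → A (suc i)) (λ i → en (suc i))))
            (en zero)

allSubsets : ∀ n → List (Subset n)
allSubsets zero    = [ [] ]
allSubsets (suc n) = concatMap (λ b → map (b ∷_) (allSubsets n)) (true ∷ false ∷ [])

E : ℕ → Set
E n = Fin n → Fin 3

r0 r1 r2 : Fin 3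
r0 = zero
r1 = suc zero
r2 = suc (suc zero)

allE : ∀ n → List (E n)
allE n = allDep n (λ _ → Fin 3) (λ _ → allFin 3)

S : ∀ {n} → Fin 3 → E n → Subset n
S j g = tabulate (λ i → does (g i Fin.≟ j))

Triple : ℕ → Set
Triple n = Subset n × Subset n × Subset n

_∩₃_ : ∀ {n} → Triple n → Triple n → Triple n
(J₁ , J₂ , J₃) ∩₃ (K₁ , K₂ , K₃) = (J₁ ∩ K₁ , J₂ ∩ K₂ , J₃ ∩ K₃)

_∪₃_ : ∀ {n} → Triple n → Triple n → Triple n
(J₁ , J₂ , J₃) ∪₃ (K₁ , K₂ , K₃) = (J₁ ∪ K₁ , J₂ ∪ K₂ , J₃ ∪ K₃)

allTriples : ∀ n → List (Triple n)
allTriples n = cartesianProduct (allSubsets n) (cartesianProduct (allSubsets n) (allSubsets n))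

-- The setup: field F, n, ℓ_i, m_i.  U_i = Fin ℓ_i × Fin m_i, where
-- (b , p) is the p-th element of block b (ℓ_i blocks of size m_i).

module Setup {c ℓ : Level} (F : Field c ℓ) (n : ℕ) (ls ms : Fin n → ℕ) where
  open Field F using (Carrier; _≈_; _+_; _*_; 0#; 1#)

  U : Fin n → Set
  U i = Fin (ls i) × Fin (ms i)

  _≟U_ : ∀ {i} (a b : U i) → Dec (a ≡ b)
  _≟U_ = ≡-dec _≟F_ _≟F_

  -- (a,b) ∈ R^i_{rel a b}
  rel : ∀ {i} → U i → U i → Fin 3
  rel (b₁ , p₁) (b₂ , p₂) with b₁ ≟F b₂ | p₁ ≟F p₂
  ... | yes _ | yes _ = r0
  ... | yes _ | no  _ = r1
  ... | no  _ | _     = r2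

  X : Set
  X = (i : Fin n) → U i

  allX : List X
  allX = allDep n U (λ i → cartesianProduct (allFin (ls i)) (allFin (ms i)))

  InR : E n → X → X → Set
  InR g x y = ∀ i → rel (x i) (y i) ≡ g i

  InR? : ∀ g x y → Dec (InR g x y)
  InR? g x y = all? (λ i → rel (x i) (y i) Fin.≟ g i)

  _≟X_ : (x y : X) → Dec (∀ i → x i ≡ y i)
  x ≟X y = all? (λ i → x i ≟U y i)

  Mat : Set c
  Mat = X → X → Carrier

  _≈M_ : Mat → Mat → Set ℓ
  M ≈M N = ∀ x y → M x y ≈ N x y

  OM : Mat
  OM _ _ = 0#

  _+M_ : Mat → Mat → Mat
  (M +M N) x y = M x y + N x y

  _·M_ : Carrier → Mat → Mat
  (a ·M M) x y = a * M x y

  _*M_ : Mat → Mat → Mat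
  (M *M N) x y = foldr (λ z s → M x z * N z y + s) 0# allX

  sumM : List Mat → Mat
  sumM = foldr _+M_ OM

  ι : ℕ → Carrier
  ι zero    = 0#
  ι (suc k) = 1# + ι k

  A : E n → Mat
  A g y z = if does (InR? g y z) then 1# else 0#

  bul : Subset n → Subset n
  bul V = tabulate (λ i → lookup V i ∧ does (2 <? ls i))

  circ : Subset n → Subset n
  circ V = tabulate (λ i → lookup V i ∧ does (2 <? ms i))

  prodFin : ∀ {k} → (Fin k → ℕ) → ℕ
  prodFin {zero}  f = 1
  prodFin {suc k} f = f zero ℕ.* prodFin (λ i → f (suc i))

  k : Triple n → ℕ
  k (J₁ , J₂ , J₃) = prodFin λ j →
      (if lookup J₁ j then ms j ∸ 1 else 1)
    ℕ.* (if lookup J₂ j then (ls j ∸ 1) ℕ.* ms j else 1)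
    ℕ.* (if lookup J₃ j ∧ Data.Bool.not (lookup J₂ j) then ms j else 1)

  InU : E n → E n → Triple n → Set
  InU g h (J₁ , J₂ , J₃) =
    J₁ ⊆ circ (S r1 g ∩ S r1 h) × J₂ ⊆ bul (S r2 g ∩ S r2 h) ×
    J₂ ⊆ J₃ × J₃ ⊆ (S r2 g ∩ S r2 h)

  InU? : ∀ g h τ → Dec (InU g h τ)
  InU? g h (J₁ , J₂ , J₃) =
    (J₁ ⊆? _) ×-dec ((J₂ ⊆? _) ×-dec ((J₂ ⊆? J₃) ×-dec (J₃ ⊆? _)))

  module Based (x : X) where

    Es : E n → Mat
    Es g y z = if does (y ≟X z) ∧ does (InR? g x y) then 1# else 0#

    data InT : Mat → Set (c ⊔ ℓ) where
      genA : ∀ g → InT (A g)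
      genE : ∀ g → InT (Es g)
      add  : ∀ {M N} → InT M → InT N → InT (M +M N)
      mul  : ∀ {M N} → InT M → InT N → InT (M *M N)
      scal : ∀ a {M} → InT M → InT (a ·M M)
      resp : ∀ {M N} → M ≈M N → InT M → InT N

    InETE : E n → Mat → Set (c ⊔ ℓ)
    InETE g N = Σ Mat λ M → InT M × N ≈M ((Es g *M M) *M Es g)

    BCond : E n → E n → Triple n → E n → Set
    BCond g h (J₁ , J₂ , J₃) a =
      (S r1 a ∩ circ (S r1 g ∩ S r1 h)) ⊆ J₁ ×
      (S r2 a ∩ bul (S r2 g ∩ S r2 h)) ⊆ J₂ ×
      (S r1 a ∩ (S r2 g ∩ S r2 h)) ⊆ J₃

    BCond? : ∀ g h τ a → Dec (BCond g h τ a)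
    BCond? g h (J₁ , J₂ , J₃) a = (_ ⊆? J₁) ×-dec ((_ ⊆? J₂) ×-dec (_ ⊆? J₃))

    -- B_{g,h,τ}  (terms with E*_g A_a E*_h = O are included; they add O)
    B : E n → E n → Triple n → Mat
    B g h τ = sumM (map (λ a → (Es g *M A a) *M Es h) (filter (BCond? g h τ) (allE n)))

    linComb : E n → (Triple n → Carrier) → Mat
    linComb g cf = sumM (map (λ α → cf α ·M B g g α) (filter (InU? g g) (allTriples n)))

{-# OPTIONS --safe #-}
module Submission where

-- Everything factorises over the n coordinates.  For y, z in the g-shell of x, B_{g,g,τ}(y,z) is 1
-- exactly when each coordinate of the relation vector of (y,z) passes a test determined by τ, so
-- (B_τ B_σ)(y,z) counts middle vertices w coordinate by coordinate; at one coordinate this is a finite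
-- case analysis on the relations among x, y, z, w, which yields the factor of k_{τ∩σ} and the test
-- of τ∪σ.  Every matrix of 𝕋 is invariant under the automorphisms fixing x, and these act
-- transitively on the shell pairs of each type (the least α ∈ 𝒰_{g,g} with B_α(y,z) = 1).  Hence an
-- element of E*_g 𝕋 E*_g is a function of the type of (y,z); as B_α is the indicator of the types
-- below α, the B_α arise from the type indicators by a unitriangular change of basis, and all these
-- functions are symmetric, which gives commutativity.

open import Defs
open import Level using (Level)
open import Algebra.Bundles using (CommutativeSemiring; CommutativeRing)
import Algebra.Properties.CommutativeSemigroup
open import Data.Fin using (Fin)
open import Data.List using (List)
open import Data.Nat using (ℕ; _≤_; _<_)
open import Data.Product using (Σ; _×_; _,_)
open import Relation.Binary using (Rel; Decidable; DecidableEquality; Reflexive)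
open import Relation.Binary.PropositionalEquality using (_≢_)
open import Relation.Unary using (Pred)
import Relation.Unary as U

module FiniteSums {c ℓ} (R : CommutativeSemiring c ℓ) where
  open import Data.Bool using (Bool; true; false; _∧_; if_then_else_; T)
  import Data.Bool.Properties as Bool
  open import Data.Fin using (Fin; zero; suc)
  open import Data.Fin.Properties using (all?) renaming (_≟_ to _≟ᶠ_)
  open import Data.List using (List; []; _∷_; _++_; foldr; map; concatMap; filter; cartesianProduct; allFin)
  open import Data.List.Properties using (map-tabulate)
  open import Data.Nat using (zero; suc)
  open import Data.Product using (_×_; _,_; proj₁; proj₂)
  open import Data.Unit using (tt)
  open import Data.Vec using (Vec; []; _∷_)
  import Data.Vec.Properties as Vec
  open import Function using (_∘_; _⇔_; mk⇔)
  open import Level using (_⊔_)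
  open import Relation.Binary using (Rel; Decidable)
  open import Relation.Binary.PropositionalEquality as ≡ using (_≡_)
  open import Relation.Nullary using (Dec; yes; no; does; _×-dec_)
  open import Relation.Nullary.Decidable using (does-⇔)

  open CommutativeSemiring R hiding (zero)
  open import Relation.Binary.Reasoning.Setoid setoid
  private
    module +-CS = Algebra.Properties.CommutativeSemigroup +-commutativeSemigroup
    module *-CS = Algebra.Properties.CommutativeSemigroup *-commutativeSemigroup

  ⟦_⟧ : Bool → Carrier
  ⟦ b ⟧ = if b then 1# else 0#

  ⟦⟧-∧ : ∀ a b → ⟦ a ∧ b ⟧ ≈ ⟦ a ⟧ * ⟦ b ⟧
  ⟦⟧-∧ true  b = sym (*-identityˡ _)
  ⟦⟧-∧ false b = sym (zeroˡ _)

  ⟦⟧-T : ∀ {b} → T b → ⟦ b ⟧ ≈ 1#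
  ⟦⟧-T {true} _ = refl

  ⟦⟧-*-cong : ∀ b {u v} → (T b → u ≈ v) → ⟦ b ⟧ * u ≈ ⟦ b ⟧ * v
  ⟦⟧-*-cong true  u≈v = *-congˡ (u≈v _)
  ⟦⟧-*-cong false _   = trans (zeroˡ _) (sym (zeroˡ _))

  ⟦⟧-idem : ∀ b u → ⟦ b ⟧ * (⟦ b ⟧ * u) ≈ ⟦ b ⟧ * u
  ⟦⟧-idem true  u = *-identityˡ _
  ⟦⟧-idem false u = trans (zeroˡ _) (sym (zeroˡ _))

  ∑ : ∀ {a} {A : Set a} → List A → (A → Carrier) → Carrier
  ∑ xs f = foldr (λ z s → f z + s) 0# xs

  syntax ∑ xs (λ z → e) = ∑[ z ∈ xs ] e

  module _ {a} {A : Set a} where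

    ∑-cong : ∀ (xs : List A) {f g : A → Carrier} → (∀ z → f z ≈ g z) → ∑ xs f ≈ ∑ xs g
    ∑-cong []       eq = refl
    ∑-cong (z ∷ xs) eq = +-cong (eq z) (∑-cong xs eq)

    ∑-zero : ∀ (xs : List A) {f : A → Carrier} → (∀ z → f z ≈ 0#) → ∑ xs f ≈ 0#
    ∑-zero []       eq = refl
    ∑-zero (z ∷ xs) eq = trans (+-cong (eq z) (∑-zero xs eq)) (+-identityˡ 0#)

    ∑-+ : ∀ (xs : List A) (f g : A → Carrier) → ∑[ z ∈ xs ] (f z + g z) ≈ ∑ xs f + ∑ xs g
    ∑-+ []       f g = sym (+-identityˡ 0#)
    ∑-+ (z ∷ xs) f g = trans (+-congˡ (∑-+ xs f g)) (+-CS.interchange (f z) (g z) (∑ xs f) (∑ xs g))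

    ∑-*ˡ : ∀ (xs : List A) (a : Carrier) (f : A → Carrier) → ∑[ z ∈ xs ] (a * f z) ≈ a * ∑ xs f
    ∑-*ˡ []       a f = sym (zeroʳ a)
    ∑-*ˡ (z ∷ xs) a f = trans (+-congˡ (∑-*ˡ xs a f)) (sym (distribˡ a (f z) (∑ xs f)))

    ∑-*ʳ : ∀ (xs : List A) (a : Carrier) (f : A → Carrier) → ∑[ z ∈ xs ] (f z * a) ≈ ∑ xs f * a
    ∑-*ʳ []       a f = sym (zeroˡ a)
    ∑-*ʳ (z ∷ xs) a f = trans (+-congˡ (∑-*ʳ xs a f)) (sym (distribʳ a (f z) (∑ xs f)))

    ∑-++ : ∀ (xs ys : List A) (f : A → Carrier) → ∑ (xs ++ ys) f ≈ ∑ xs f + ∑ ys f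
    ∑-++ []       ys f = sym (+-identityˡ _)
    ∑-++ (z ∷ xs) ys f = trans (+-congˡ (∑-++ xs ys f)) (sym (+-assoc _ _ _))

    ∑-filter : ∀ {p} {P : A → Set p} (P? : ∀ z → Dec (P z)) (xs : List A) (f : A → Carrier) →
               ∑ (filter P? xs) f ≈ ∑[ z ∈ xs ] (⟦ does (P? z) ⟧ * f z)
    ∑-filter P? []       f = refl
    ∑-filter P? (z ∷ xs) f with does (P? z)
    ... | true  = +-cong (sym (*-identityˡ _)) (∑-filter P? xs f)
    ... | false = trans (∑-filter P? xs f) (sym (trans (+-congʳ (zeroˡ _)) (+-identityˡ _)))

  ∑-map : ∀ {a b} {A : Set a} {B : Set b} (h : A → B) (xs : List A) (f : B → Carrier) →
          ∑ (map h xs) f ≡ ∑[ z ∈ xs ] f (h z)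
  ∑-map h []       f = ≡.refl
  ∑-map h (z ∷ xs) f = ≡.cong (f (h z) +_) (∑-map h xs f)

  module _ {a b} {A : Set a} {B : Set b} where

    ∑-concatMap : ∀ (h : A → List B) (xs : List A) (f : B → Carrier) →
                  ∑ (concatMap h xs) f ≈ ∑[ z ∈ xs ] ∑ (h z) f
    ∑-concatMap h []       f = refl
    ∑-concatMap h (z ∷ xs) f = trans (∑-++ (h z) (concatMap h xs) f) (+-congˡ (∑-concatMap h xs f))

    ∑-comm : ∀ (xs : List A) (ys : List B) (f : A → B → Carrier) →
             ∑[ u ∈ xs ] ∑[ v ∈ ys ] f u v ≈ ∑[ v ∈ ys ] ∑[ u ∈ xs ] f u v
    ∑-comm []       ys f = sym (∑-zero ys (λ _ → refl))
    ∑-comm (z ∷ xs) ys f = trans (+-congˡ (∑-comm xs ys f)) (sym (∑-+ ys (f z) _))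

    ∑∑-* : ∀ (xs : List A) (ys : List B) (f : A → Carrier) (g : B → Carrier) →
           ∑[ u ∈ xs ] ∑[ v ∈ ys ] (f u * g v) ≈ ∑ xs f * ∑ ys g
    ∑∑-* xs ys f g = trans (∑-cong xs (λ u → ∑-*ˡ ys (f u) g)) (∑-*ʳ xs (∑ ys g) f)

    ∑-cartesianProduct : ∀ (xs : List A) (ys : List B) (f : A × B → Carrier) →
                         ∑ (cartesianProduct xs ys) f ≈ ∑[ u ∈ xs ] ∑[ v ∈ ys ] f (u , v)
    ∑-cartesianProduct []       ys f = refl
    ∑-cartesianProduct (z ∷ xs) ys f =
      trans (∑-++ (map (z ,_) ys) _ f) (+-cong (reflexive (∑-map (z ,_) ys f)) (∑-cartesianProduct xs ys f))

  ∑-concatMap-map : ∀ {a b d} {A : Set a} {B : Set b} {D : Set d} (xs : List A) (ys : List B)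
                    (h : A → B → D) (f : D → Carrier) →
                    ∑ (concatMap (λ u → map (h u) ys) xs) f ≈ ∑[ u ∈ xs ] ∑[ v ∈ ys ] f (h u v)
  ∑-concatMap-map xs ys h f = trans (∑-concatMap _ xs f) (∑-cong xs (λ u → reflexive (∑-map (h u) ys f)))

  ∑-allFin-suc : ∀ k (f : Fin (suc k) → Carrier) → ∑ (allFin (suc k)) f ≡ f zero + ∑[ i ∈ allFin k ] f (suc i)
  ∑-allFin-suc k f =
    ≡.cong (f zero +_) (≡.trans (≡.cong (λ is → ∑ is f) (≡.sym (map-tabulate (λ i → i) suc))) (∑-map suc (allFin k) f))

  ∏ : ∀ {k} → (Fin k → Carrier) → Carrier
  ∏ {zero}  f = 1#
  ∏ {suc k} f = f zero * ∏ (f ∘ suc)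

  ∏-cong : ∀ {k} {f g : Fin k → Carrier} → (∀ i → f i ≈ g i) → ∏ f ≈ ∏ g
  ∏-cong {zero}  eq = refl
  ∏-cong {suc k} eq = *-cong (eq zero) (∏-cong (eq ∘ suc))

  ∏-one : ∀ {k} {f : Fin k → Carrier} → (∀ i → f i ≈ 1#) → ∏ f ≈ 1#
  ∏-one {zero}  eq = refl
  ∏-one {suc k} eq = trans (*-cong (eq zero) (∏-one (eq ∘ suc))) (*-identityˡ 1#)

  ∏-* : ∀ {k} (f h : Fin k → Carrier) → ∏ (λ i → f i * h i) ≈ ∏ f * ∏ h
  ∏-* {zero}  f h = sym (*-identityˡ 1#)
  ∏-* {suc k} f h = trans (*-congˡ (∏-* (f ∘ suc) (h ∘ suc))) (*-CS.interchange (f zero) (h zero) _ _)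

  ⟦all?⟧ : ∀ {k p} {P : Fin k → Set p} (P? : ∀ i → Dec (P i)) → ⟦ does (all? P?) ⟧ ≈ ∏ (λ i → ⟦ does (P? i) ⟧)
  ⟦all?⟧ {zero}  P? = reflexive (≡.cong ⟦_⟧ (does-⇔ (mk⇔ (λ _ → tt) (λ _ ())) (all? P?) (yes tt)))
  ⟦all?⟧ {suc k} P? = begin
    ⟦ does (all? P?) ⟧                              ≡⟨ ≡.cong ⟦_⟧ (does-⇔ split (all? P?) (P? zero ×-dec all? (P? ∘ suc))) ⟩
    ⟦ does (P? zero) ∧ does (all? (P? ∘ suc)) ⟧     ≈⟨ ⟦⟧-∧ _ _ ⟩
    ⟦ does (P? zero) ⟧ * ⟦ does (all? (P? ∘ suc)) ⟧ ≈⟨ *-congˡ (⟦all?⟧ (P? ∘ suc)) ⟩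
    ∏ (λ i → ⟦ does (P? i) ⟧)                       ∎
    where
    split = mk⇔ (λ h → h zero , h ∘ suc) (λ { (h₀ , h) zero → h₀ ; (h₀ , h) (suc i) → h i })

  ∑-allDep-∏ : ∀ n (A : Fin n → Set) (en : ∀ i → List (A i)) (f : ∀ i → A i → Carrier) →
               ∑[ w ∈ allDep n A en ] ∏ (λ i → f i (w i)) ≈ ∏ (λ i → ∑ (en i) (f i))
  ∑-allDep-∏ zero    A en f = +-identityʳ 1#
  ∑-allDep-∏ (suc n) A en f = begin
    ∑[ w ∈ allDep (suc n) A en ] ∏ (λ i → f i (w i))
      ≈⟨ ∑-concatMap-map (en zero) (allDep n (A ∘ suc) (en ∘ suc)) _ _ ⟩
    ∑[ a ∈ en zero ] ∑[ w ∈ allDep n (A ∘ suc) (en ∘ suc) ] (f zero a * ∏ (λ i → f (suc i) (w i)))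
      ≈⟨ ∑∑-* (en zero) (allDep n (A ∘ suc) (en ∘ suc)) (f zero) _ ⟩
    ∑ (en zero) (f zero) * ∑[ w ∈ allDep n (A ∘ suc) (en ∘ suc) ] ∏ (λ i → f (suc i) (w i))
      ≈⟨ *-congˡ (∑-allDep-∏ n (A ∘ suc) (en ∘ suc) (f ∘ suc)) ⟩
    ∏ (λ i → ∑ (en i) (f i)) ∎

  record Enumerates {a r} {A : Set a} {_~_ : Rel A r} (_≟_ : Decidable _~_) (xs : List A) : Set (a ⊔ ℓ) where
    field
      counts-once : ∀ c → ∑[ z ∈ xs ] ⟦ does (z ≟ c) ⟧ ≈ 1#

  open Enumerates public

  module _ {a r} {A : Set a} {_~_ : Rel A r} (_≟_ : Decidable _~_) {xs : List A} (enum : Enumerates _≟_ xs) where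

    ∑-pick : ∀ c (f : A → Carrier) → (∀ z → z ~ c → f z ≈ f c) → ∑[ z ∈ xs ] (⟦ does (z ≟ c) ⟧ * f z) ≈ f c
    ∑-pick c f f-resp = begin
      ∑[ z ∈ xs ] (⟦ does (z ≟ c) ⟧ * f z) ≈⟨ ∑-cong xs at-c ⟩
      ∑[ z ∈ xs ] (⟦ does (z ≟ c) ⟧ * f c) ≈⟨ ∑-*ʳ xs (f c) _ ⟩
      ∑[ z ∈ xs ] ⟦ does (z ≟ c) ⟧ * f c   ≈⟨ *-congʳ (counts-once enum c) ⟩
      1# * f c                             ≈⟨ *-identityˡ (f c) ⟩
      f c                                  ∎
      where
      at-c : ∀ z → ⟦ does (z ≟ c) ⟧ * f z ≈ ⟦ does (z ≟ c) ⟧ * f c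
      at-c z with z ≟ c
      ... | yes z~c = *-congˡ (f-resp z z~c)
      ... | no  _   = trans (zeroˡ _) (sym (zeroˡ _))

    Enumerates-⇔ : ∀ {r′} {_≈′_ : Rel A r′} (_≟′_ : Decidable _≈′_) → (∀ {z c} → z ~ c ⇔ z ≈′ c) → Enumerates _≟′_ xs
    Enumerates-⇔ _≟′_ equiv = record { counts-once = λ c →
      trans (∑-cong xs (λ z → reflexive (≡.cong ⟦_⟧ (≡.sym (does-⇔ equiv (z ≟ c) (z ≟′ c)))))) (counts-once enum c) }

    ∑-reindex : (f f⁻¹ : A → A) → (∀ {v w} → v ~ f w ⇔ w ~ f⁻¹ v) →
                ∀ (h : A → Carrier) → (∀ v c → v ~ c → h v ≈ h c) → ∑[ w ∈ xs ] h (f w) ≈ ∑ xs h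
    ∑-reindex f f⁻¹ inverse h h-resp = begin
      ∑[ w ∈ xs ] h (f w)                                  ≈⟨ ∑-cong xs (λ w → ∑-pick (f w) h (λ v → h-resp v (f w))) ⟨
      ∑[ w ∈ xs ] ∑[ v ∈ xs ] (⟦ does (v ≟ f w) ⟧ * h v)    ≈⟨ ∑-comm xs xs _ ⟩
      ∑[ v ∈ xs ] ∑[ w ∈ xs ] (⟦ does (v ≟ f w) ⟧ * h v)    ≈⟨ ∑-cong xs (λ v → ∑-cong xs (λ w → *-congʳ (reflexive
                                                                (≡.cong ⟦_⟧ (does-⇔ inverse (v ≟ f w) (w ≟ f⁻¹ v)))))) ⟩
      ∑[ v ∈ xs ] ∑[ w ∈ xs ] (⟦ does (w ≟ f⁻¹ v) ⟧ * h v)  ≈⟨ ∑-cong xs (λ v → trans (∑-*ʳ xs (h v) _)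
                                                                (trans (*-congʳ (counts-once enum (f⁻¹ v))) (*-identityˡ (h v)))) ⟩
      ∑ xs h                                               ∎

  allFin-enumerates : ∀ k → Enumerates _≟ᶠ_ (allFin k)
  allFin-enumerates k = record { counts-once = once k }
    where
    once : ∀ k (c : Fin k) → ∑[ i ∈ allFin k ] ⟦ does (i ≟ᶠ c) ⟧ ≈ 1#
    once (suc k) zero    =
      trans (reflexive (∑-allFin-suc k _)) (trans (+-congˡ (∑-zero (allFin k) (λ _ → refl))) (+-identityʳ 1#))
    once (suc k) (suc c) = trans (reflexive (∑-allFin-suc k _)) (trans (+-identityˡ _) (once k c))

  module _ {a b r s} {A : Set a} {B : Set b} {_~₁_ : Rel A r} {_~₂_ : Rel B s}
           (_≟₁_ : Decidable _~₁_) (_≟₂_ : Decidable _~₂_) where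

    _≟×_ : Decidable (λ (p q : A × B) → proj₁ p ~₁ proj₁ q × proj₂ p ~₂ proj₂ q)
    (u , v) ≟× (u′ , v′) = (u ≟₁ u′) ×-dec (v ≟₂ v′)

    cartesianProduct-enumerates : ∀ {xs ys} → Enumerates _≟₁_ xs → Enumerates _≟₂_ ys →
                                  Enumerates _≟×_ (cartesianProduct xs ys)
    cartesianProduct-enumerates {xs} {ys} enum₁ enum₂ = record { counts-once = once }
      where
      once : ∀ c → ∑ (cartesianProduct xs ys) (λ p → ⟦ does (p ≟× c) ⟧) ≈ 1#
      once (c₁ , c₂) = begin
        ∑ (cartesianProduct xs ys) (λ p → ⟦ does (p ≟× (c₁ , c₂)) ⟧)        ≈⟨ ∑-cartesianProduct xs ys _ ⟩
        ∑[ u ∈ xs ] ∑[ v ∈ ys ] ⟦ does (u ≟₁ c₁) ∧ does (v ≟₂ c₂) ⟧          ≈⟨ ∑-cong xs (λ u → ∑-cong ys (λ v → ⟦⟧-∧ _ _)) ⟩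
        ∑[ u ∈ xs ] ∑[ v ∈ ys ] (⟦ does (u ≟₁ c₁) ⟧ * ⟦ does (v ≟₂ c₂) ⟧)   ≈⟨ ∑∑-* xs ys _ _ ⟩
        ∑[ u ∈ xs ] ⟦ does (u ≟₁ c₁) ⟧ * ∑[ v ∈ ys ] ⟦ does (v ≟₂ c₂) ⟧     ≈⟨ *-cong (counts-once enum₁ c₁) (counts-once enum₂ c₂) ⟩
        1# * 1#                                                             ≈⟨ *-identityˡ 1# ⟩
        1#                                                                  ∎

  allDep-enumerates : ∀ n (A : Fin n → Set) (en : ∀ i → List (A i)) {r} {_~_ : ∀ i → Rel (A i) r}
                      (_≟_ : ∀ i → Decidable (_~_ i)) → (∀ i → Enumerates (_≟_ i) (en i)) →
                      Enumerates (λ w w′ → all? (λ i → _≟_ i (w i) (w′ i))) (allDep n A en)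
  allDep-enumerates n A en _≟_ enum = record { counts-once = λ c → begin
    ∑[ w ∈ allDep n A en ] ⟦ does (all? (λ i → _≟_ i (w i) (c i))) ⟧
      ≈⟨ ∑-cong (allDep n A en) (λ w → ⟦all?⟧ (λ i → _≟_ i (w i) (c i))) ⟩
    ∑[ w ∈ allDep n A en ] ∏ (λ i → ⟦ does (_≟_ i (w i) (c i)) ⟧)
      ≈⟨ ∑-allDep-∏ n A en (λ i u → ⟦ does (_≟_ i u (c i)) ⟧) ⟩
    ∏ (λ i → ∑[ u ∈ en i ] ⟦ does (_≟_ i u (c i)) ⟧)
      ≈⟨ ∏-one (λ i → counts-once (enum i) (c i)) ⟩
    1# ∎ }

  allSubsets-enumerates : ∀ n → Enumerates (Vec.≡-dec Bool._≟_) (allSubsets n)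
  allSubsets-enumerates n = record { counts-once = once n }
    where
    _≟ᵛ_ : ∀ {m} (p q : Vec Bool m) → Dec (p ≡ q)
    _≟ᵛ_ = Vec.≡-dec Bool._≟_

    bools : ∀ b → ∑[ a ∈ true ∷ false ∷ [] ] ⟦ does (a Bool.≟ b) ⟧ ≈ 1#
    bools true  = trans (+-congˡ (+-identityˡ 0#)) (+-identityʳ 1#)
    bools false = trans (+-identityˡ _) (+-identityʳ 1#)

    once : ∀ n (c : Vec Bool n) → ∑[ q ∈ allSubsets n ] ⟦ does (q ≟ᵛ c) ⟧ ≈ 1#
    once zero    []      = +-identityʳ 1#
    once (suc n) (b ∷ p) = begin
      ∑[ q ∈ allSubsets (suc n) ] ⟦ does (q ≟ᵛ (b ∷ p)) ⟧
        ≈⟨ ∑-concatMap-map (true ∷ false ∷ []) (allSubsets n) _∷_ _ ⟩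
      ∑[ a ∈ true ∷ false ∷ [] ] ∑[ q ∈ allSubsets n ] ⟦ does (a Bool.≟ b) ∧ does (q ≟ᵛ p) ⟧
        ≈⟨ ∑-cong (true ∷ false ∷ []) (λ a → ∑-cong (allSubsets n) (λ q → ⟦⟧-∧ (does (a Bool.≟ b)) (does (q ≟ᵛ p)))) ⟩
      ∑[ a ∈ true ∷ false ∷ [] ] ∑[ q ∈ allSubsets n ] (⟦ does (a Bool.≟ b) ⟧ * ⟦ does (q ≟ᵛ p) ⟧)
        ≈⟨ ∑∑-* (true ∷ false ∷ []) (allSubsets n) (λ a → ⟦ does (a Bool.≟ b) ⟧) _ ⟩
      ∑[ a ∈ true ∷ false ∷ [] ] ⟦ does (a Bool.≟ b) ⟧ * ∑[ q ∈ allSubsets n ] ⟦ does (q ≟ᵛ p) ⟧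
        ≈⟨ *-cong (bools b) (once n p) ⟩
      1# * 1#
        ≈⟨ *-identityˡ 1# ⟩
      1# ∎

module Unitriangular {c ℓ a} (R : CommutativeRing c ℓ) {A : Set a} (_≟_ : DecidableEquality A) (xs : List A)
  {p} {P : Pred A p} (P? : U.Decidable P)
  {r} {_≼_ : Rel A r} (_≼?_ : Decidable _≼_) (≼-refl : Reflexive _≼_)
  (height : A → ℕ) (height-< : ∀ {s t} → s ≼ t → t ≢ s → height t < height s) where
  open import Data.Bool using (Bool; _∧_; not)
  open import Data.Nat using (zero; suc; s≤s)
  open import Relation.Binary.PropositionalEquality as ≡ using ()
  open import Data.Bool.Properties using (∧-identityʳ)
  open import Data.Nat.Properties using (<-≤-trans; ≤-pred; n<1+n)
  open import Data.Nat.Induction using (<-wellFounded)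
  open import Data.Product using (Σ; _,_)
  open import Induction.WellFounded using (module All)
  import Relation.Binary.Construct.On as On
  open import Relation.Nullary using (yes; no; does)
  open import Relation.Nullary.Decidable using (dec-true)

  open CommutativeRing R
  open import Relation.Binary.Reasoning.Setoid setoid
  open FiniteSums commutativeSemiring

  ζ : (A → Carrier) → A → Carrier
  ζ f s = ∑[ t ∈ xs ] (⟦ does (P? t) ∧ does (s ≼? t) ⟧ * f t)

  strictlyAbove : (A → Carrier) → A → Carrier
  strictlyAbove f s = ∑[ t ∈ xs ] (⟦ does (P? t) ∧ does (s ≼? t) ∧ not (does (t ≟ s)) ⟧ * f t)

  module _ (enum : Enumerates _≟_ xs) where

    ζ-split : ∀ f {s} → P s → ζ f s ≈ f s + strictlyAbove f s
    ζ-split f {s} Ps = begin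
      ζ f s                                                          ≈⟨ ∑-cong xs split ⟩
      ∑[ t ∈ xs ] (⟦ does (t ≟ s) ⟧ * f t + ⟦ above t ⟧ * f t)        ≈⟨ ∑-+ xs _ _ ⟩
      ∑[ t ∈ xs ] (⟦ does (t ≟ s) ⟧ * f t) + strictlyAbove f s       ≈⟨ +-congʳ (∑-pick _≟_ enum s f (λ { _ ≡.refl → refl })) ⟩
      f s + strictlyAbove f s                                        ∎
      where
      above : A → Bool
      above t = does (P? t) ∧ does (s ≼? t) ∧ not (does (t ≟ s))

      split : ∀ t → ⟦ does (P? t) ∧ does (s ≼? t) ⟧ * f t ≈ ⟦ does (t ≟ s) ⟧ * f t + ⟦ above t ⟧ * f t
      split t with t ≟ s
      ... | yes ≡.refl rewrite dec-true (P? t) Ps | dec-true (t ≼? t) ≼-refl =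
        trans (sym (+-identityʳ _)) (+-congˡ (sym (zeroˡ _)))
      ... | no _ = trans (sym (+-identityˡ _))
                         (+-cong (sym (zeroˡ _)) (*-congʳ (reflexive (≡.cong (λ b → ⟦ does (P? t) ∧ b ⟧) (≡.sym (∧-identityʳ _))))))

    strictlyAbove-zero : ∀ f s → (∀ t → P t → s ≼ t → t ≢ s → f t ≈ 0#) → strictlyAbove f s ≈ 0#
    strictlyAbove-zero f s vanish = ∑-zero xs term
      where
      term : ∀ t → ⟦ does (P? t) ∧ does (s ≼? t) ∧ not (does (t ≟ s)) ⟧ * f t ≈ 0#
      term t with P? t | s ≼? t | t ≟ s
      ... | yes Pt | yes s≼t | no t≢s = trans (*-identityˡ _) (vanish t Pt s≼t t≢s)
      ... | yes _  | yes _   | yes _  = zeroˡ _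
      ... | yes _  | no  _   | _      = zeroˡ _
      ... | no  _  | _       | _      = zeroˡ _

    strictlyAbove-cong : ∀ f g s → (∀ t → P t → s ≼ t → t ≢ s → f t ≈ g t) → strictlyAbove f s ≈ strictlyAbove g s
    strictlyAbove-cong f g s agree = ∑-cong xs term
      where
      term : ∀ t → ⟦ does (P? t) ∧ does (s ≼? t) ∧ not (does (t ≟ s)) ⟧ * f t ≈
                   ⟦ does (P? t) ∧ does (s ≼? t) ∧ not (does (t ≟ s)) ⟧ * g t
      term t with P? t | s ≼? t | t ≟ s
      ... | yes Pt | yes s≼t | no t≢s = *-congˡ (agree t Pt s≼t t≢s)
      ... | yes _  | yes _   | yes _  = trans (zeroˡ _) (sym (zeroˡ _))
      ... | yes _  | no  _   | _      = trans (zeroˡ _) (sym (zeroˡ _))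
      ... | no  _  | _       | _      = trans (zeroˡ _) (sym (zeroˡ _))

    ζ-injective : ∀ f → (∀ s → P s → ζ f s ≈ 0#) → ∀ s → P s → f s ≈ 0#
    ζ-injective f ζf≈0 = All.wfRec (On.wellFounded height <-wellFounded) _ (λ s → P s → f s ≈ 0#) step
      where
      step : ∀ s → (∀ {t} → height t < height s → P t → f t ≈ 0#) → P s → f s ≈ 0#
      step s below Ps = begin
        f s                       ≈⟨ +-identityʳ (f s) ⟨
        f s + 0#                  ≈⟨ +-congˡ (strictlyAbove-zero f s (λ t Pt s≼t t≢s → below (height-< s≼t t≢s) Pt)) ⟨
        f s + strictlyAbove f s   ≈⟨ ζ-split f Ps ⟨
        ζ f s                     ≈⟨ ζf≈0 s Ps ⟩
        0#                        ∎

    ζ-surjective : ∀ (v : A → Carrier) → Σ (A → Carrier) λ f → ∀ s → P s → ζ f s ≈ v s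
    ζ-surjective v = f , solves
      where
      -- approx k s is the solution at every s of height < k (back-substitution from the top).
      approx : ℕ → A → Carrier
      approx zero    s = 0#
      approx (suc k) s = v s - strictlyAbove (approx k) s

      approx-stable : ∀ k s → height s < k → ∀ k′ → k ≤ k′ → approx k′ s ≈ approx k s
      approx-stable (suc k) s hs<k (suc k′) (s≤s k≤k′) =
        +-congˡ (-‿cong (strictlyAbove-cong _ _ s λ t _ s≼t t≢s →
          approx-stable k t (<-≤-trans (height-< s≼t t≢s) (≤-pred hs<k)) k′ k≤k′))

      f : A → Carrier
      f s = approx (suc (height s)) s

      solves : ∀ s → P s → ζ f s ≈ v s
      solves s Ps = begin
        ζ f s                                                                   ≈⟨ ζ-split f Ps ⟩
        (v s - strictlyAbove (approx (height s)) s) + strictlyAbove f s         ≈⟨ +-congˡ (strictlyAbove-cong _ _ s stable) ⟩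
        (v s - strictlyAbove (approx (height s)) s) + strictlyAbove (approx (height s)) s
                                                                                ≈⟨ +-assoc _ _ _ ⟩
        v s + (- strictlyAbove (approx (height s)) s + strictlyAbove (approx (height s)) s)
                                                                                ≈⟨ +-congˡ (-‿inverseˡ _) ⟩
        v s + 0#                                                                ≈⟨ +-identityʳ (v s) ⟩
        v s                                                                     ∎
        where
        stable : ∀ t → P t → s ≼ t → t ≢ s → f t ≈ approx (height s) t
        stable t _ s≼t t≢s = sym (approx-stable (suc (height t)) t (n<1+n _) (height s) (height-< s≼t t≢s))

module SingleCoordinate where
  open import Data.Bool using (Bool; true; false; _∧_; _∨_; not; if_then_else_; T)
  import Data.Bool.Properties as Bool
  open import Data.Fin using (Fin)
  open import Data.Fin.Patterns using (0F; 1F; 2F)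
  open import Data.Fin.Properties using (_≟_)
  import Data.Product.Properties as Product
  open import Data.Product using (_×_; _,_)
  open import Data.Unit using (tt)
  open import Relation.Binary.PropositionalEquality using (_≡_)
  open import Relation.Nullary using (Dec; does; map′; _×-dec_; _→-dec_)
  open import Relation.Nullary.Decidable using (T?; toWitness)

  infix  7 _==_
  infixr 4 _⇒_

  _==_ : Fin 3 → Fin 3 → Bool
  r == s = does (r ≟ s)

  _⇒_ : Bool → Bool → Bool
  true  ⇒ b = b
  false ⇒ _ = true

  ∀ᵇ? : ∀ {p} {P : Bool → Set p} → (∀ b → Dec (P b)) → Dec (∀ b → P b)
  ∀ᵇ? P? = map′ (λ { (t , f) true → t ; (t , f) false → f }) (λ h → h true , h false) (P? true ×-dec P? false)

  ∀³? : ∀ {p} {P : Fin 3 → Set p} → (∀ r → Dec (P r)) → Dec (∀ r → P r)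
  ∀³? P? = map′ (λ { (p₀ , p₁ , p₂) 0F → p₀ ; (p₀ , p₁ , p₂) 1F → p₁ ; (p₀ , p₁ , p₂) 2F → p₂ })
                (λ h → h 0F , h 1F , h 2F) (P? 0F ×-dec P? 1F ×-dec P? 2F)

  -- The trace (i ∈ J₁ , i ∈ J₂ , i ∈ J₃) of a triple of subsets at one coordinate i.
  Flags : Set
  Flags = Bool × Bool × Bool

  ∀ᶠ? : ∀ {p} {P : Flags → Set p} → (∀ j → Dec (P j)) → Dec (∀ j → P j)
  ∀ᶠ? P? = map′ (λ h (j₁ , j₂ , j₃) → h j₁ j₂ j₃) (λ h j₁ j₂ j₃ → h (j₁ , j₂ , j₃))
                (∀ᵇ? λ j₁ → ∀ᵇ? λ j₂ → ∀ᵇ? λ j₃ → P? (j₁ , j₂ , j₃))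

  _≟ᶠ_ : (j k : Flags) → Dec (j ≡ k)
  _≟ᶠ_ = Product.≡-dec Bool._≟_ (Product.≡-dec Bool._≟_ Bool._≟_)

  _∧ᶠ_ _∨ᶠ_ : Flags → Flags → Flags
  (j₁ , j₂ , j₃) ∧ᶠ (k₁ , k₂ , k₃) = (j₁ ∧ k₁ , j₂ ∧ k₂ , j₃ ∧ k₃)
  (j₁ , j₂ , j₃) ∨ᶠ (k₁ , k₂ , k₃) = (j₁ ∨ k₁ , j₂ ∨ k₂ , j₃ ∨ k₃)

  _≼_ : Flags → Flags → Bool
  (j₁ , j₂ , j₃) ≼ (k₁ , k₂ , k₃) = (j₁ ⇒ k₁) ∧ (j₂ ⇒ k₂) ∧ (j₃ ⇒ k₃)

  relationOf : (sameBlock samePosition : Bool) → Fin 3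
  relationOf true  true  = 0F
  relationOf true  false = 1F
  relationOf false _     = 2F

  sameBlock : Fin 3 → Bool
  sameBlock r = not (r == 2F)

  transitive : Bool → Bool → Bool → Bool
  transitive a b c = (a ∧ b ⇒ c) ∧ (b ∧ c ⇒ a) ∧ (a ∧ c ⇒ b)

  -- Can r = R(a,b), s = R(b,c), t = R(a,c) hold for three points a, b, c?  With only two blocks
  -- (positions per block) no three blocks (positions in one block) are pairwise distinct.
  triangle : (L>2 M>2 : Bool) → Fin 3 → Fin 3 → Fin 3 → Bool
  triangle L>2 M>2 r s t =
    transitive (sameBlock r) (sameBlock s) (sameBlock t) ∧ transitive (r == 0F) (s == 0F) (t == 0F) ∧
    (L>2 ∨ not (r == 2F ∧ s == 2F ∧ t == 2F)) ∧ (M>2 ∨ not (r == 1F ∧ s == 1F ∧ t == 1F))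

  -- Lemmas proved by `toWitness … tt` are checked by evaluating a decision procedure on all cases.
  triangle-relationOf : ∀ L>2 M>2 d₁ d₂ d₃ e₁ e₂ e₃ → T (transitive d₁ d₂ d₃) → T (transitive e₁ e₂ e₃) →
                        T (L>2 ∨ d₁ ∨ d₂ ∨ d₃) → T (M>2 ∨ e₁ ∨ e₂ ∨ e₃) →
                        T (triangle L>2 M>2 (relationOf d₁ e₁) (relationOf d₂ e₂) (relationOf d₃ e₃))
  triangle-relationOf = toWitness {a? = ∀ᵇ? λ L>2 → ∀ᵇ? λ M>2 → ∀ᵇ? λ d₁ → ∀ᵇ? λ d₂ → ∀ᵇ? λ d₃ →
    ∀ᵇ? λ e₁ → ∀ᵇ? λ e₂ → ∀ᵇ? λ e₃ → T? (transitive d₁ d₂ d₃) →-dec T? (transitive e₁ e₂ e₃) →-dec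
    T? (L>2 ∨ d₁ ∨ d₂ ∨ d₃) →-dec T? (M>2 ∨ e₁ ∨ e₂ ∨ e₃) →-dec
    T? (triangle L>2 M>2 (relationOf d₁ e₁) (relationOf d₂ e₂) (relationOf d₃ e₃))} tt

  triangle-L>2 : ∀ L>2 M>2 → T (triangle L>2 M>2 2F 2F 2F) → T L>2
  triangle-L>2 true _ _ = tt

  triangle-M>2 : ∀ L>2 M>2 → T (triangle L>2 M>2 1F 1F 1F) → T M>2
  triangle-M>2 true  true _ = tt
  triangle-M>2 false true _ = tt

  -- Sets of middle vertices u, described by the relations of u to x, y and z.
  data Region : Set where
    at-y at-z near-y near-z beside-x away-from-x : Region

  inRegion : Region → (R[x,u] R[y,u] R[u,z] : Fin 3) → Bool
  inRegion at-y        _  s₂ _  = s₂ == 0F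
  inRegion at-z        _  _  s₃ = s₃ == 0F
  inRegion near-y      _  s₂ _  = sameBlock s₂
  inRegion near-z      _  _  s₃ = sameBlock s₃
  inRegion beside-x    s₁ _  _  = s₁ == 1F
  inRegion away-from-x s₁ _  _  = s₁ == 2F

  region : Flags → Flags → Region
  region (j₁ , j₂ , j₃) (k₁ , k₂ , k₃) =
    if j₁ ∧ k₁ then beside-x else
    if j₂ ∧ k₂ then away-from-x else
    if j₃ ∧ k₃ then (if k₂ then near-y else near-z) else
    if k₁ ∨ k₃ then at-y else at-z

  consistent : Flags → Bool
  consistent (a₁ , a₂ , a₃) = (a₁ ⇒ not a₂ ∧ not a₃) ∧ (a₂ ⇒ a₃)

  -- The coordinate i of the sets occurring in 𝒰_{g,g} and in B_{g,g,τ}, for g_i = g.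
  module Coordinate (L>2 M>2 : Bool) (g : Fin 3) where

    S₁° S₂• S₂ : Bool
    S₁° = g == 1F ∧ M>2
    S₂• = g == 2F ∧ L>2
    S₂  = g == 2F

    admissible : Flags → Bool
    admissible (j₁ , j₂ , j₃) = (j₁ ⇒ S₁°) ∧ (j₂ ⇒ S₂•) ∧ (j₂ ⇒ j₃) ∧ (j₃ ⇒ S₂)

    allows : Flags → Fin 3 → Bool
    allows (j₁ , j₂ , j₃) r = (r == 1F ∧ S₁° ⇒ j₁) ∧ (r == 2F ∧ S₂• ⇒ j₂) ∧ (r == 1F ∧ S₂ ⇒ j₃)

    typeOf : Fin 3 → Flags
    typeOf r = (r == 1F ∧ S₁° , r == 2F ∧ S₂• , (r == 1F ∧ S₂) ∨ (r == 2F ∧ S₂•))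

    realise : Flags → Fin 3
    realise (j₁ , j₂ , j₃) =
      if g == 1F then (if j₁ then 1F else 0F) else
      if g == 2F then (if j₂ then 2F else if j₃ then 1F else 0F) else 0F

  -- s₁ = R(x,u), s₂ = R(y,u), s₃ = R(u,z) and t = R(y,z), for y, z in the g-shell of x.
  pathCondition-factorises : ∀ L>2 M>2 g → let open Coordinate L>2 M>2 g in
    ∀ j → T (admissible j) → ∀ k → T (admissible k) → ∀ s₁ s₂ s₃ t →
    T (triangle L>2 M>2 g s₂ s₁) → T (triangle L>2 M>2 s₁ s₃ g) → T (triangle L>2 M>2 s₂ s₃ t) → T (triangle L>2 M>2 g t g) →
    (s₁ == g ∧ allows j s₂ ∧ allows k s₃) ≡ (allows (j ∨ᶠ k) t ∧ inRegion (region j k) s₁ s₂ s₃)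
  pathCondition-factorises = toWitness {a? = ∀ᵇ? λ L>2 → ∀ᵇ? λ M>2 → ∀³? λ g → let open Coordinate L>2 M>2 g in
    ∀ᶠ? λ j → T? (admissible j) →-dec ∀ᶠ? λ k → T? (admissible k) →-dec ∀³? λ s₁ → ∀³? λ s₂ → ∀³? λ s₃ → ∀³? λ t →
    T? (triangle L>2 M>2 g s₂ s₁) →-dec T? (triangle L>2 M>2 s₁ s₃ g) →-dec
    T? (triangle L>2 M>2 s₂ s₃ t) →-dec T? (triangle L>2 M>2 g t g) →-dec
    (s₁ == g ∧ allows j s₂ ∧ allows k s₃) Bool.≟ (allows (j ∨ᶠ k) t ∧ inRegion (region j k) s₁ s₂ s₃)} tt

  admissible-consistent : ∀ L>2 M>2 g → let open Coordinate L>2 M>2 g in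
    ∀ j → T (admissible j) → ∀ k → T (admissible k) → T (consistent (j ∧ᶠ k))
  admissible-consistent = toWitness {a? = ∀ᵇ? λ L>2 → ∀ᵇ? λ M>2 → ∀³? λ g → let open Coordinate L>2 M>2 g in
    ∀ᶠ? λ j → T? (admissible j) →-dec ∀ᶠ? λ k → T? (admissible k) →-dec T? (consistent (j ∧ᶠ k))} tt

  allows-typeOf : ∀ L>2 M>2 g → let open Coordinate L>2 M>2 g in
    ∀ j → T (admissible j) → ∀ r → allows j r ≡ typeOf r ≼ j
  allows-typeOf = toWitness {a? = ∀ᵇ? λ L>2 → ∀ᵇ? λ M>2 → ∀³? λ g → let open Coordinate L>2 M>2 g in
    ∀ᶠ? λ j → T? (admissible j) →-dec ∀³? λ r → allows j r Bool.≟ typeOf r ≼ j} tt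

  typeOf-spec : ∀ L>2 M>2 g → let open Coordinate L>2 M>2 g in
    ∀ r → T (triangle L>2 M>2 g r g) → T (admissible (typeOf r)) × realise (typeOf r) ≡ r
  typeOf-spec = toWitness {a? = ∀ᵇ? λ L>2 → ∀ᵇ? λ M>2 → ∀³? λ g → let open Coordinate L>2 M>2 g in
    ∀³? λ r → T? (triangle L>2 M>2 g r g) →-dec T? (admissible (typeOf r)) ×-dec realise (typeOf r) ≟ r} tt

  realise-spec : ∀ L>2 M>2 g → let open Coordinate L>2 M>2 g in
    ∀ j → T (admissible j) → typeOf (realise j) ≡ j × T (triangle L>2 M>2 g (realise j) g)
  realise-spec = toWitness {a? = ∀ᵇ? λ L>2 → ∀ᵇ? λ M>2 → ∀³? λ g → let open Coordinate L>2 M>2 g in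
    ∀ᶠ? λ j → T? (admissible j) →-dec typeOf (realise j) ≟ᶠ j ×-dec T? (triangle L>2 M>2 g (realise j) g)} tt

module FinFacts where
  open import Data.Bool using (Bool; true; false; _∧_; _∨_; not; T)
  import Data.Bool.Properties as Bool
  open import Data.Empty using (⊥-elim)
  open import Data.Fin using (Fin; punchIn)
  open import Data.Fin.Subset using (Subset; _⊆_; ∣_∣)
  open import Data.Fin.Subset.Properties using (drop-∷-⊆; p⊆q⇒∣p∣≤∣q∣)
  open import Data.Vec using ([]; _∷_; here; lookup)
  open import Data.Vec.Properties using ([]=⇒lookup; lookup⇒[]=)
  open import Data.Fin.Patterns using (0F; 1F)
  open import Data.Fin.Permutation.Components using (transpose; transpose-inverse)
  open import Data.Fin.Properties using (_≟_; punchInᵢ≢i; punchIn-injective)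
  open import Data.List using (allFin)
  open import Data.Nat as ℕ using (ℕ; _≤_; _<_; _<?_; _∸_; s≤s)
  open import Data.Nat.Properties using (+-*-commutativeSemiring; m+n∸m≡n)
  open import Data.Product using (_×_; _,_; proj₁; proj₂)
  open import Data.Unit using (tt)
  open import Function using (_∘_; _⇔_; mk⇔; Equivalence)
  open import Relation.Binary.PropositionalEquality using (_≡_; _≢_; refl; cong; sym; trans; module ≡-Reasoning)
  open import Relation.Nullary using (Dec; yes; no; does)
  open import Relation.Nullary.Decidable using (does-⇔)
  open SingleCoordinate using (transitive; _⇒_)
  open FiniteSums +-*-commutativeSemiring using (⟦_⟧; ∑; ∑-cong; ∑-+; ∑-allFin-suc; allFin-enumerates; counts-once)

  T-does : ∀ {p} {P : Set p} (d : Dec P) → T (does d) ⇔ P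
  T-does (yes p) = mk⇔ (λ _ → p) (λ _ → _)
  T-does (no ¬p) = mk⇔ (λ ()) ¬p

  ∀-T-∧ : ∀ {k} {f h : Fin k → Bool} → ((∀ i → T (f i)) × (∀ i → T (h i))) ⇔ (∀ i → T (f i ∧ h i))
  ∀-T-∧ = mk⇔ (λ (tf , th) i → Bool.T-∧ .Equivalence.from (tf i , th i))
              (λ t → (λ i → proj₁ (Bool.T-∧ .Equivalence.to (t i))) , (λ i → proj₂ (Bool.T-∧ .Equivalence.to (t i))))

  ⊆-lookup : ∀ {k} {p q : Subset k} {f h : Fin k → Bool} → (∀ i → lookup p i ≡ f i) → (∀ i → lookup q i ≡ h i) →
             p ⊆ q ⇔ (∀ i → T (f i ⇒ h i))
  ⊆-lookup {p = p} {q} {f} {h} p≡f q≡h = mk⇔ to from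
    where
    to : p ⊆ q → ∀ i → T (f i ⇒ h i)
    to p⊆q i with f i in fi
    ... | false = _
    ... | true  = Bool.T-≡ .Equivalence.from (trans (sym (q≡h i)) ([]=⇒lookup (p⊆q (lookup⇒[]= i p (trans (p≡f i) fi)))))
    from : (∀ i → T (f i ⇒ h i)) → p ⊆ q
    from f⇒h {i} i∈p = lookup⇒[]= i q (trans (q≡h i) (Bool.T-≡ .Equivalence.to (implies (f⇒h i))))
      where
      implies : T (f i ⇒ h i) → T (h i)
      implies rewrite sym (p≡f i) | []=⇒lookup i∈p = λ t → t

  ⊆-≢⇒∣<∣ : ∀ {k} {p q : Subset k} → p ⊆ q → p ≢ q → ∣ p ∣ < ∣ q ∣
  ⊆-≢⇒∣<∣ {p = []}        {[]}        _   p≢q = ⊥-elim (p≢q refl)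
  ⊆-≢⇒∣<∣ {p = true ∷ p}  {true ∷ q}  p⊆q p≢q = s≤s (⊆-≢⇒∣<∣ (drop-∷-⊆ p⊆q) (p≢q ∘ cong (true ∷_)))
  ⊆-≢⇒∣<∣ {p = false ∷ p} {false ∷ q} p⊆q p≢q = ⊆-≢⇒∣<∣ (drop-∷-⊆ p⊆q) (p≢q ∘ cong (false ∷_))
  ⊆-≢⇒∣<∣ {p = false ∷ p} {true ∷ q}  p⊆q _   = s≤s (p⊆q⇒∣p∣≤∣q∣ (drop-∷-⊆ p⊆q))
  ⊆-≢⇒∣<∣ {p = true ∷ p}  {false ∷ q} p⊆q _   with () ← p⊆q here

  ≟-sym : ∀ {k} (a b : Fin k) → does (a ≟ b) ≡ does (b ≟ a)
  ≟-sym a b = does-⇔ (mk⇔ sym sym) (a ≟ b) (b ≟ a)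

  transitive-≟ : ∀ {k} (a b c : Fin k) → T (transitive (does (a ≟ b)) (does (b ≟ c)) (does (a ≟ c)))
  transitive-≟ a b c with a ≟ b | b ≟ c | a ≟ c
  ... | yes a≡b | yes b≡c | no  a≢c = a≢c (trans a≡b b≡c)
  ... | yes a≡b | no  b≢c | yes a≡c = b≢c (trans (sym a≡b) a≡c)
  ... | no  a≢b | yes b≡c | yes a≡c = a≢b (trans a≡c (sym b≡c))
  ... | yes _   | yes _   | yes _   = tt
  ... | yes _   | no  _   | no  _   = tt
  ... | no  _   | yes _   | no  _   = tt
  ... | no  _   | no  _   | yes _   = tt
  ... | no  _   | no  _   | no  _   = tt

  pigeonhole : ∀ {k} (a b c : Fin k) → T (does (2 <? k) ∨ does (a ≟ b) ∨ does (b ≟ c) ∨ does (a ≟ c))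
  pigeonhole {ℕ.suc (ℕ.suc (ℕ.suc _))} _ _ _ = tt
  pigeonhole {1} 0F 0F 0F = tt
  pigeonhole {2} 0F 0F _  = tt
  pigeonhole {2} 1F 1F _  = tt
  pigeonhole {2} 0F 1F 0F = tt
  pigeonhole {2} 0F 1F 1F = tt
  pigeonhole {2} 1F 0F 0F = tt
  pigeonhole {2} 1F 0F 1F = tt

  transpose-injective : ∀ {k} (i j : Fin k) {a b} → transpose i j a ≡ transpose i j b → a ≡ b
  transpose-injective i j e = trans (sym (transpose-inverse j i)) (trans (cong (transpose j i) e) (transpose-inverse j i))

  ≟-transpose : ∀ {k} (i j a b : Fin k) → does (transpose i j a ≟ transpose i j b) ≡ does (a ≟ b)
  ≟-transpose i j a b = does-⇔ (mk⇔ (transpose-injective i j) (cong (transpose i j))) (transpose i j a ≟ transpose i j b) (a ≟ b)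

  transpose-source : ∀ {k} (i j : Fin k) → transpose i j i ≡ j
  transpose-source i j with i ≟ i
  ... | yes _  = refl
  ... | no i≢i = ⊥-elim (i≢i refl)

  transpose-fixes : ∀ {k} (i j a : Fin k) → does (a ≟ i) ≡ does (a ≟ j) → transpose i j a ≡ a
  transpose-fixes i j a e with a ≟ i
  transpose-fixes i j a e  | yes _ with a ≟ j
  transpose-fixes i j a e  | yes _ | yes a≡j = sym a≡j
  transpose-fixes i j a () | yes _ | no  _
  transpose-fixes i j a e  | no  _ with a ≟ j
  transpose-fixes i j a e  | no  _ | no  _   = refl
  transpose-fixes i j a () | no  _ | yes _

  -- Junk values for k < 2 (resp. k < 3); only used when the size hypotheses hold.
  otherThan : ∀ {k} → Fin k → Fin k
  otherThan {ℕ.suc (ℕ.suc _)} a = punchIn a 0F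
  otherThan                   a = a

  secondOtherThan : ∀ {k} → Fin k → Fin k
  secondOtherThan {ℕ.suc (ℕ.suc (ℕ.suc _))} a = punchIn a 1F
  secondOtherThan                           a = a

  otherThan-≢ : ∀ {k} → 2 ≤ k → (a : Fin k) → a ≢ otherThan a
  otherThan-≢ (s≤s (s≤s _)) a = punchInᵢ≢i a 0F ∘ sym

  secondOtherThan-≢ : ∀ {k} → 2 < k → (a : Fin k) → a ≢ secondOtherThan a × otherThan a ≢ secondOtherThan a
  secondOtherThan-≢ (s≤s (s≤s (s≤s _))) a = punchInᵢ≢i a 1F ∘ sym , (λ ()) ∘ punchIn-injective a 0F 1F

  count-all : ∀ k → ∑[ i ∈ allFin k ] ⟦ true ⟧ ≡ k
  count-all ℕ.zero    = refl
  count-all (ℕ.suc k) = trans (∑-allFin-suc k (λ _ → ⟦ true ⟧)) (cong ℕ.suc (count-all k))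

  count-≡ : ∀ {k} (c : Fin k) → ∑[ i ∈ allFin k ] ⟦ does (c ≟ i) ⟧ ≡ 1
  count-≡ {k} c = trans (∑-cong (allFin k) (λ i → cong ⟦_⟧ (≟-sym c i))) (counts-once (allFin-enumerates k) c)

  count-≢ : ∀ {k} (c : Fin k) → ∑[ i ∈ allFin k ] ⟦ not (does (c ≟ i)) ⟧ ≡ k ∸ 1
  count-≢ {k} c = begin
    others                                                 ≡⟨ m+n∸m≡n 1 others ⟨
    1 ℕ.+ others ∸ 1                                       ≡⟨ cong (λ m → m ℕ.+ others ∸ 1) (count-≡ c) ⟨
    ∑[ i ∈ allFin k ] ⟦ does (c ≟ i) ⟧ ℕ.+ others ∸ 1     ≡⟨ cong (_∸ 1) (∑-+ (allFin k) _ _) ⟨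
    ∑[ i ∈ allFin k ] (⟦ does (c ≟ i) ⟧ ℕ.+ ⟦ not (does (c ≟ i)) ⟧) ∸ 1
                                                           ≡⟨ cong (_∸ 1) (∑-cong (allFin k) (λ i → ⟦b⟧+⟦¬b⟧ (does (c ≟ i)))) ⟩
    ∑[ i ∈ allFin k ] ⟦ true ⟧ ∸ 1                         ≡⟨ cong (_∸ 1) (count-all k) ⟩
    k ∸ 1                                                  ∎
    where
    open ≡-Reasoning
    others = ∑[ i ∈ allFin k ] ⟦ not (does (c ≟ i)) ⟧
    ⟦b⟧+⟦¬b⟧ : ∀ b → ⟦ b ⟧ ℕ.+ ⟦ not b ⟧ ≡ 1
    ⟦b⟧+⟦¬b⟧ true  = refl
    ⟦b⟧+⟦¬b⟧ false = refl

module Triples (n : ℕ) where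
  open import Data.Bool using (_∧_; _∨_; T)
  import Data.Bool.Properties as Bool
  open import Data.Empty using (⊥-elim)
  open import Data.Fin using (Fin)
  open import Data.Fin.Subset using (Subset; _⊆_; ∣_∣)
  open import Data.Fin.Subset.Properties using (_⊆?_; p⊆q⇒∣p∣≤∣q∣; ∣p∣≤n)
  open import Data.Nat using (_+_; _∸_; _<_)
  open import Data.Nat.Properties using (∸-monoʳ-<; +-mono-≤; +-mono-<-≤; +-mono-≤-<)
  open import Data.Product using (_×_; _,_; proj₁; proj₂)
  import Data.Product.Properties as Product
  open import Data.Product.Function.NonDependent.Propositional using (_×-⇔_)
  open import Data.Vec using (lookup)
  import Data.Vec.Properties as Vec
  open import Function using (_∘_; _⇔_)
  import Function.Properties.Equivalence as ⇔
  open import Relation.Binary.PropositionalEquality using (_≡_; _≢_; refl; cong; cong₂; sym; trans)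
  open import Relation.Nullary using (Dec; yes; no; _×-dec_)
  open SingleCoordinate using (Flags; _∧ᶠ_; _∨ᶠ_; _≼_)
  open FinFacts using (⊆-lookup; ∀-T-∧; ⊆-≢⇒∣<∣)

  _≟ˢ_ : (p q : Subset n) → Dec (p ≡ q)
  _≟ˢ_ = Vec.≡-dec Bool._≟_

  _≟₃_ : (s t : Triple n) → Dec (s ≡ t)
  _≟₃_ = Product.≡-dec _≟ˢ_ (Product.≡-dec _≟ˢ_ _≟ˢ_)

  _‼_ : Triple n → Fin n → Flags
  (J₁ , J₂ , J₃) ‼ i = lookup J₁ i , lookup J₂ i , lookup J₃ i

  ‼-∩ : ∀ τ σ i → (τ ∩₃ σ) ‼ i ≡ (τ ‼ i) ∧ᶠ (σ ‼ i)
  ‼-∩ (J₁ , J₂ , J₃) (K₁ , K₂ , K₃) i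
    rewrite Vec.lookup-zipWith _∧_ i J₁ K₁ | Vec.lookup-zipWith _∧_ i J₂ K₂ | Vec.lookup-zipWith _∧_ i J₃ K₃ = refl

  ‼-∪ : ∀ τ σ i → (τ ∪₃ σ) ‼ i ≡ (τ ‼ i) ∨ᶠ (σ ‼ i)
  ‼-∪ (J₁ , J₂ , J₃) (K₁ , K₂ , K₃) i
    rewrite Vec.lookup-zipWith _∨_ i J₁ K₁ | Vec.lookup-zipWith _∨_ i J₂ K₂ | Vec.lookup-zipWith _∨_ i J₃ K₃ = refl

  ‼-injective : ∀ {s t} → (∀ i → s ‼ i ≡ t ‼ i) → s ≡ t
  ‼-injective {J₁ , J₂ , J₃} {K₁ , K₂ , K₃} s≡t =
    cong₂ _,_ (vec-ext (cong proj₁ ∘ s≡t))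
              (cong₂ _,_ (vec-ext (cong (proj₁ ∘ proj₂) ∘ s≡t)) (vec-ext (cong (proj₂ ∘ proj₂) ∘ s≡t)))
    where
    vec-ext : ∀ {p q : Subset n} → (∀ i → lookup p i ≡ lookup q i) → p ≡ q
    vec-ext {p} {q} e = trans (sym (Vec.tabulate∘lookup p)) (trans (Vec.tabulate-cong e) (Vec.tabulate∘lookup q))

  _⊆₃_ : Triple n → Triple n → Set
  (J₁ , J₂ , J₃) ⊆₃ (K₁ , K₂ , K₃) = J₁ ⊆ K₁ × J₂ ⊆ K₂ × J₃ ⊆ K₃

  _⊆₃?_ : ∀ s t → Dec (s ⊆₃ t)
  (J₁ , J₂ , J₃) ⊆₃? (K₁ , K₂ , K₃) = (J₁ ⊆? K₁) ×-dec (J₂ ⊆? K₂) ×-dec (J₃ ⊆? K₃)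

  ⊆₃-refl : ∀ {t} → t ⊆₃ t
  ⊆₃-refl = (λ p → p) , (λ p → p) , (λ p → p)

  ⊆₃⇔ : ∀ s t → s ⊆₃ t ⇔ (∀ i → T ((s ‼ i) ≼ (t ‼ i)))
  ⊆₃⇔ (J₁ , J₂ , J₃) (K₁ , K₂ , K₃) = ⇔.trans
    (⊆-lookup (λ _ → refl) (λ _ → refl) ×-⇔ ⊆-lookup (λ _ → refl) (λ _ → refl) ×-⇔ ⊆-lookup (λ _ → refl) (λ _ → refl))
    (⇔.trans (⇔.refl ×-⇔ ∀-T-∧) ∀-T-∧)

  size : Triple n → ℕ
  size (J₁ , J₂ , J₃) = ∣ J₁ ∣ + ∣ J₂ ∣ + ∣ J₃ ∣

  height : Triple n → ℕ
  height t = n + n + n ∸ size t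

  height-< : ∀ {s t} → s ⊆₃ t → t ≢ s → height t < height s
  height-< {J₁ , J₂ , J₃} {K₁ , K₂ , K₃} (s₁ , s₂ , s₃) t≢s =
    ∸-monoʳ-< size< (+-mono-≤ (+-mono-≤ (∣p∣≤n K₁) (∣p∣≤n K₂)) (∣p∣≤n K₃))
    where
    size< : size (J₁ , J₂ , J₃) < size (K₁ , K₂ , K₃)
    size< with J₁ ≟ˢ K₁ | J₂ ≟ˢ K₂ | J₃ ≟ˢ K₃
    ... | yes refl | yes refl | yes refl = ⊥-elim (t≢s refl)
    ... | no J₁≢K₁ | _        | _        =
      +-mono-<-≤ (+-mono-<-≤ (⊆-≢⇒∣<∣ s₁ J₁≢K₁) (p⊆q⇒∣p∣≤∣q∣ s₂)) (p⊆q⇒∣p∣≤∣q∣ s₃)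
    ... | yes _    | no J₂≢K₂ | _        =
      +-mono-<-≤ (+-mono-≤-< (p⊆q⇒∣p∣≤∣q∣ s₁) (⊆-≢⇒∣<∣ s₂ J₂≢K₂)) (p⊆q⇒∣p∣≤∣q∣ s₃)
    ... | yes _    | yes _    | no J₃≢K₃ =
      +-mono-≤-< (+-mono-≤ (p⊆q⇒∣p∣≤∣q∣ s₁) (p⊆q⇒∣p∣≤∣q∣ s₂)) (⊆-≢⇒∣<∣ s₃ J₃≢K₃)

module Blocks (L M : ℕ) where
  open import Data.Bool using (Bool; true; false; _∧_; _∨_; not; if_then_else_; T)
  open import Data.Fin using (Fin)
  open import Data.Fin.Patterns using (0F; 1F; 2F)
  open import Data.Fin.Permutation.Components using (transpose; transpose-inverse)
  open import Data.Fin.Properties using (_≟_)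
  open import Data.List using (List; allFin; cartesianProduct)
  open import Data.Nat using (_≤_; _<?_; _∸_; _*_)
  open import Data.Nat.Properties using (+-*-commutativeSemiring; *-identityˡ; *-identityʳ; +-identityʳ; *-comm; ≤ᵇ⇒≤)
  open import Data.Product using (Σ-syntax; _×_; _,_; proj₁; proj₂)
  open import Function using (_∘_)
  open import Relation.Binary.PropositionalEquality as ≡ using (_≡_; _≢_; refl; cong; cong₂; sym; trans; module ≡-Reasoning)
  open import Relation.Nullary using (yes; no; does)
  open import Relation.Nullary.Decidable using (dec-true; dec-false)
  open SingleCoordinate
  open FinFacts
  open FiniteSums +-*-commutativeSemiring using (⟦_⟧; ⟦⟧-∧; ∑; ∑-cong; ∑-cartesianProduct; ∑∑-*; ∑-*ˡ)

  Point : Set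
  Point = Fin L × Fin M

  points : List Point
  points = cartesianProduct (allFin L) (allFin M)

  rel : Point → Point → Fin 3
  rel (b , p) (b′ , p′) = relationOf (does (b ≟ b′)) (does (p ≟ p′))

  L>2 M>2 : Bool
  L>2 = does (2 <? L)
  M>2 = does (2 <? M)

  rel-sym : ∀ u v → rel u v ≡ rel v u
  rel-sym (b , p) (b′ , p′) = cong₂ relationOf (≟-sym b b′) (≟-sym p p′)

  rel-refl : ∀ u → rel u u ≡ 0F
  rel-refl (b , p) = cong₂ relationOf (dec-true (b ≟ b) refl) (dec-true (p ≟ p) refl)

  rel-beside : ∀ b {p p′} → p ≢ p′ → rel (b , p) (b , p′) ≡ 1F
  rel-beside b {p} {p′} p≢p′ = cong₂ relationOf (dec-true (b ≟ b) refl) (dec-false (p ≟ p′) p≢p′)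

  rel-away : ∀ {b b′} p p′ → b ≢ b′ → rel (b , p) (b′ , p′) ≡ 2F
  rel-away {b} {b′} p p′ b≢b′ = cong (λ d → relationOf d (does (p ≟ p′))) (dec-false (b ≟ b′) b≢b′)

  relationOf-block : ∀ {d e d′ e′} → relationOf d e ≡ relationOf d′ e′ → d ≡ d′
  relationOf-block {true}  {true}  {true}  {true}  _ = refl
  relationOf-block {true}  {true}  {true}  {false} _ = refl
  relationOf-block {true}  {false} {true}  {true}  _ = refl
  relationOf-block {true}  {false} {true}  {false} _ = refl
  relationOf-block {false} {_}     {false} {_}     _ = refl
  relationOf-block {true}  {true}  {false} ()
  relationOf-block {true}  {false} {false} ()
  relationOf-block {false} {_}     {true}  {true}  ()
  relationOf-block {false} {_}     {true}  {false} ()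

  relationOf-position : ∀ {e d′ e′} → relationOf true e ≡ relationOf d′ e′ → e ≡ e′
  relationOf-position {true}  {true} {true}  _ = refl
  relationOf-position {false} {true} {false} _ = refl
  relationOf-position {true}  {true} {false} ()
  relationOf-position {false} {true} {true}  ()
  relationOf-position {true}  {false} ()
  relationOf-position {false} {false} ()

  rel-triangle : ∀ a b c → T (triangle L>2 M>2 (rel a b) (rel b c) (rel a c))
  rel-triangle (ba , pa) (bb , pb) (bc , pc) =
    triangle-relationOf L>2 M>2 (does (ba ≟ bb)) (does (bb ≟ bc)) (does (ba ≟ bc)) (does (pa ≟ pb)) (does (pb ≟ pc)) (does (pa ≟ pc))
      (transitive-≟ ba bb bc) (transitive-≟ pa pb pc) (pigeonhole ba bb bc) (pigeonhole pa pb pc)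

  record Automorphism : Set where
    field
      to from : Point → Point
      from-to : ∀ u → from (to u) ≡ u
      to-from : ∀ u → to (from u) ≡ u
      rel-to  : ∀ u v → rel (to u) (to v) ≡ rel u v

  open Automorphism public

  _∘ᴬ_ : Automorphism → Automorphism → Automorphism
  π ∘ᴬ σ = record
    { to      = to π ∘ to σ
    ; from    = from σ ∘ from π
    ; from-to = λ u → trans (cong (from σ) (from-to π (to σ u))) (from-to σ u)
    ; to-from = λ u → trans (cong (to π) (to-from σ (from π u))) (to-from π u)
    ; rel-to  = λ u v → trans (rel-to π (to σ u) (to σ v)) (rel-to σ u v)
    }

  blockSwap : Fin L → Fin L → Automorphism
  blockSwap a b = record
    { to      = λ (c , p) → transpose a b c , p
    ; from    = λ (c , p) → transpose b a c , p
    ; from-to = λ (c , p) → cong (_, p) (transpose-inverse b a)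
    ; to-from = λ (c , p) → cong (_, p) (transpose-inverse a b)
    ; rel-to  = λ (c , p) (c′ , p′) → cong (λ d → relationOf d _) (≟-transpose a b c c′)
    }

  swapIn : Fin L → Fin M → Fin M → Point → Point
  swapIn B p q (c , r) = c , (if does (c ≟ B) then transpose p q r else r)

  swapIn-inverse : ∀ B p q u → swapIn B q p (swapIn B p q u) ≡ u
  swapIn-inverse B p q (c , r) with does (c ≟ B)
  ... | true  = cong (c ,_) (transpose-inverse q p)
  ... | false = refl

  swapIn-rel : ∀ B p q u v → rel (swapIn B p q u) (swapIn B p q v) ≡ rel u v
  swapIn-rel B p q (c , r) (c′ , r′) with c ≟ c′
  ... | no  _    = refl
  ... | yes refl = cong (relationOf true) (positions (does (c ≟ B)))
    where
    positions : ∀ b → does ((if b then transpose p q r else r) ≟ (if b then transpose p q r′ else r′)) ≡ does (r ≟ r′)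
    positions true  = ≟-transpose p q r r′
    positions false = refl

  swapIn-fixes : ∀ B p q w → (proj₁ w ≡ B → does (proj₂ w ≟ p) ≡ does (proj₂ w ≟ q)) → swapIn B p q w ≡ w
  swapIn-fixes B p q (c , r) same with c ≟ B
  ... | yes c≡B = cong (c ,_) (transpose-fixes p q r (same c≡B))
  ... | no  _   = refl

  pointSwap : Fin L → Fin M → Fin M → Automorphism
  pointSwap B p q = record
    { to      = swapIn B p q
    ; from    = swapIn B q p
    ; from-to = swapIn-inverse B p q
    ; to-from = swapIn-inverse B q p
    ; rel-to  = swapIn-rel B p q
    }

  move : ∀ z z′ → Σ[ π ∈ Automorphism ] to π z ≡ z′ × (∀ w → rel w z ≡ rel w z′ → to π w ≡ w)
  move (bz , pz) (bz′ , pz′) = pointSwap bz′ pz pz′ ∘ᴬ blockSwap bz bz′ , moves , fixes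
    where
    moves : swapIn bz′ pz pz′ (transpose bz bz′ bz , pz) ≡ (bz′ , pz′)
    moves rewrite transpose-source bz bz′ | dec-true (bz′ ≟ bz′) refl = cong (bz′ ,_) (transpose-source pz pz′)

    fixes : ∀ w → rel w (bz , pz) ≡ rel w (bz′ , pz′) → swapIn bz′ pz pz′ (transpose bz bz′ (proj₁ w) , proj₂ w) ≡ w
    fixes (bw , pw) e =
      trans (cong (λ c → swapIn bz′ pz pz′ (c , pw)) (transpose-fixes bz bz′ bw (relationOf-block e)))
            (swapIn-fixes bz′ pz pz′ (bw , pw) same)
      where
      same : bw ≡ bz′ → does (pw ≟ pz) ≡ does (pw ≟ pz′)
      same bw≡bz′ = relationOf-position
        (≡.subst (λ d → relationOf d _ ≡ _) (trans (relationOf-block e) (dec-true (bw ≟ bz′) bw≡bz′)) e)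

  move₂ : ∀ x y z y′ z′ → rel x y ≡ rel x y′ → rel x z ≡ rel x z′ → rel y z ≡ rel y′ z′ →
          Σ[ π ∈ Automorphism ] to π x ≡ x × to π y ≡ y′ × to π z ≡ z′
  move₂ x y z y′ z′ xy xz yz with move y y′
  ... | π₁ , y↦y′ , fix₁ with move (to π₁ z) z′
  ... | π₂ , z↦z′ , fix₂ = π₂ ∘ᴬ π₁ , x-fixed , y-moved , z↦z′
    where
    x-fixed₁ : to π₁ x ≡ x
    x-fixed₁ = fix₁ x xy

    x-fixed : to π₂ (to π₁ x) ≡ x
    x-fixed = trans (cong (to π₂) x-fixed₁)
                    (fix₂ x (trans (cong (λ v → rel v (to π₁ z)) (sym x-fixed₁)) (trans (rel-to π₁ x z) xz)))

    y-moved : to π₂ (to π₁ y) ≡ y′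
    y-moved = trans (cong (to π₂) y↦y′)
                    (fix₂ y′ (trans (cong (λ v → rel v (to π₁ z)) (sym y↦y′)) (trans (rel-to π₁ y z) yz)))

  size : (Point → Bool) → ℕ
  size P = ∑[ u ∈ points ] ⟦ P u ⟧

  size-× : ∀ (A : Fin L → Bool) (B : Fin M → Bool) →
           size (λ u → A (proj₁ u) ∧ B (proj₂ u)) ≡ ∑[ b ∈ allFin L ] ⟦ A b ⟧ * ∑[ p ∈ allFin M ] ⟦ B p ⟧
  size-× A B = trans (∑-cartesianProduct (allFin L) (allFin M) _)
                     (trans (∑-cong (allFin L) (λ b → ∑-cong (allFin M) (λ p → ⟦⟧-∧ (A b) (B p))))
                            (∑∑-* (allFin L) (allFin M) _ _))

  size-rel : ∀ w (h : Fin 3 → Bool) (A : Bool → Bool) (B : Bool → Bool) → (∀ d e → h (relationOf d e) ≡ A d ∧ B e) →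
             size (λ u → h (rel w u)) ≡ ∑[ b ∈ allFin L ] ⟦ A (does (proj₁ w ≟ b)) ⟧ * ∑[ p ∈ allFin M ] ⟦ B (does (proj₂ w ≟ p)) ⟧
  size-rel (b , p) h A B split =
    trans (∑-cong points (λ (b′ , p′) → cong ⟦_⟧ (split (does (b ≟ b′)) (does (p ≟ p′))))) (size-× _ _)

  size-equal : ∀ w → size (λ u → rel w u == 0F) ≡ 1
  size-equal w = trans (size-rel w (_== 0F) (λ d → d) (λ e → e) λ { true true → refl ; true false → refl ; false _ → refl })
                       (cong₂ _*_ (count-≡ (proj₁ w)) (count-≡ (proj₂ w)))

  size-beside : ∀ w → size (λ u → rel w u == 1F) ≡ M ∸ 1
  size-beside w = trans (size-rel w (_== 1F) (λ d → d) not λ { true true → refl ; true false → refl ; false _ → refl })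
                        (trans (cong₂ _*_ (count-≡ (proj₁ w)) (count-≢ (proj₂ w))) (*-identityˡ _))

  size-away : ∀ w → size (λ u → rel w u == 2F) ≡ (L ∸ 1) * M
  size-away w = trans (size-rel w (_== 2F) not (λ _ → true) λ { true true → refl ; true false → refl ; false _ → refl })
                      (cong₂ _*_ (count-≢ (proj₁ w)) (count-all M))

  size-block : ∀ w → size (λ u → sameBlock (rel w u)) ≡ M
  size-block w = trans (size-rel w sameBlock (λ d → d) (λ _ → true) λ { true true → refl ; true false → refl ; false _ → refl })
                       (trans (cong₂ _*_ (count-≡ (proj₁ w)) (count-all M)) (*-identityˡ M))

  size-flip : ∀ z (h : Fin 3 → Bool) → size (λ u → h (rel u z)) ≡ size (λ u → h (rel z u))
  size-flip z h = ∑-cong points (λ u → cong (⟦_⟧ ∘ h) (rel-sym u z))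

  valency : Flags → ℕ
  valency (a₁ , a₂ , a₃) = (if a₁ then M ∸ 1 else 1) * (if a₂ then (L ∸ 1) * M else 1) * (if a₃ ∧ not a₂ then M else 1)

  regionSize : Region → ℕ
  regionSize at-y        = 1
  regionSize at-z        = 1
  regionSize near-y      = M
  regionSize near-z      = M
  regionSize beside-x    = M ∸ 1
  regionSize away-from-x = (L ∸ 1) * M

  size-inRegion : ∀ b x y z → size (λ u → inRegion b (rel x u) (rel y u) (rel u z)) ≡ regionSize b
  size-inRegion at-y        x y z = size-equal y
  size-inRegion at-z        x y z = trans (size-flip z (_== 0F)) (size-equal z)
  size-inRegion near-y      x y z = size-block y
  size-inRegion near-z      x y z = trans (size-flip z sameBlock) (size-block z)
  size-inRegion beside-x    x y z = size-beside x
  size-inRegion away-from-x x y z = size-away x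

  regionSize-region : ∀ j k → T (consistent (j ∧ᶠ k)) → regionSize (region j k) ≡ valency (j ∧ᶠ k)
  regionSize-region (j₁ , j₂ , j₃) (k₁ , k₂ , k₃) with j₁ ∧ k₁ | j₂ ∧ k₂ | j₃ ∧ k₃
  ... | true  | false | false = λ _ → sym (trans (*-identityʳ _) (*-identityʳ _))
  ... | false | true  | true  = λ _ → sym (trans (*-identityʳ _) (*-identityˡ _))
  ... | false | false | true  = λ _ → trans (near k₂) (sym (+-identityʳ M))
    where
    near : ∀ b → regionSize (if b then near-y else near-z) ≡ M
    near true  = refl
    near false = refl
  ... | false | false | false = λ _ → at (k₁ ∨ k₃)
    where
    at : ∀ b → regionSize (if b then at-y else at-z) ≡ 1
    at true  = refl
    at false = refl
  ... | true  | true  | _     = λ ()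
  ... | true  | false | true  = λ ()
  ... | false | true  | false = λ ()

  module _ (g : Fin 3) where
    open Coordinate L>2 M>2 g

    coordinate-count : ∀ x y z → rel x y ≡ g → rel x z ≡ g → ∀ j → T (admissible j) → ∀ k → T (admissible k) →
      size (λ u → rel x u == g ∧ allows j (rel y u) ∧ allows k (rel u z)) ≡ valency (j ∧ᶠ k) * ⟦ allows (j ∨ᶠ k) (rel y z) ⟧
    coordinate-count x y z xy xz j adm-j k adm-k = begin
      size (λ u → rel x u == g ∧ allows j (rel y u) ∧ allows k (rel u z))
        ≡⟨ ∑-cong points (λ u → cong ⟦_⟧ (factorise u)) ⟩
      size (λ u → allows (j ∨ᶠ k) (rel y z) ∧ inRegion (region j k) (rel x u) (rel y u) (rel u z))
        ≡⟨ ∑-cong points (λ u → ⟦⟧-∧ (allows (j ∨ᶠ k) (rel y z)) _) ⟩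
      ∑[ u ∈ points ] (⟦ allows (j ∨ᶠ k) (rel y z) ⟧ * ⟦ inRegion (region j k) (rel x u) (rel y u) (rel u z) ⟧)
        ≡⟨ ∑-*ˡ points ⟦ allows (j ∨ᶠ k) (rel y z) ⟧ (λ u → ⟦ inRegion (region j k) (rel x u) (rel y u) (rel u z) ⟧) ⟩
      ⟦ allows (j ∨ᶠ k) (rel y z) ⟧ * size (λ u → inRegion (region j k) (rel x u) (rel y u) (rel u z))
        ≡⟨ cong (⟦ allows (j ∨ᶠ k) (rel y z) ⟧ *_) (trans (size-inRegion (region j k) x y z)
             (regionSize-region j k (admissible-consistent L>2 M>2 g j adm-j k adm-k))) ⟩
      ⟦ allows (j ∨ᶠ k) (rel y z) ⟧ * valency (j ∧ᶠ k)
        ≡⟨ *-comm ⟦ allows (j ∨ᶠ k) (rel y z) ⟧ (valency (j ∧ᶠ k)) ⟩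
      valency (j ∧ᶠ k) * ⟦ allows (j ∨ᶠ k) (rel y z) ⟧ ∎
      where
      open ≡-Reasoning
      factorise : ∀ u → (rel x u == g ∧ allows j (rel y u) ∧ allows k (rel u z)) ≡
                        (allows (j ∨ᶠ k) (rel y z) ∧ inRegion (region j k) (rel x u) (rel y u) (rel u z))
      factorise u = pathCondition-factorises L>2 M>2 g j adm-j k adm-k (rel x u) (rel y u) (rel u z) (rel y z)
        (≡.subst (λ h → T (triangle L>2 M>2 h (rel y u) (rel x u))) xy (rel-triangle x y u))
        (≡.subst (λ h → T (triangle L>2 M>2 (rel x u) (rel u z) h)) xz (rel-triangle x u z))
        (rel-triangle y u z)
        (≡.subst₂ (λ h h′ → T (triangle L>2 M>2 h (rel y z) h′)) xy xz (rel-triangle x y z))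

  pairFor : Point → Fin 3 → Fin 3 → Point × Point
  pairFor (b , p) 1F 1F = (b , otherThan p) , (b , secondOtherThan p)
  pairFor (b , p) 1F _  = (b , otherThan p) , (b , otherThan p)
  pairFor (b , p) 2F 1F = (otherThan b , p) , (otherThan b , otherThan p)
  pairFor (b , p) 2F 2F = (otherThan b , p) , (secondOtherThan b , p)
  pairFor (b , p) 2F _  = (otherThan b , p) , (otherThan b , p)
  pairFor x       _  _  = x , x

  pairFor-rel : 2 ≤ L → 2 ≤ M → ∀ x g r → T (triangle L>2 M>2 g r g) →
                rel x (proj₁ (pairFor x g r)) ≡ g × rel x (proj₂ (pairFor x g r)) ≡ g ×
                rel (proj₁ (pairFor x g r)) (proj₂ (pairFor x g r)) ≡ r
  pairFor-rel _   _   x       0F 0F _ = rel-refl x , rel-refl x , rel-refl x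
  pairFor-rel _   _   x       0F 1F ()
  pairFor-rel _   _   x       0F 2F ()
  pairFor-rel _   _   x       1F 2F ()
  pairFor-rel _   2≤M (b , p) 1F 0F _ =
    rel-beside b (otherThan-≢ 2≤M p) , rel-beside b (otherThan-≢ 2≤M p) , rel-refl (b , otherThan p)
  pairFor-rel _   2≤M (b , p) 1F 1F t =
    rel-beside b (otherThan-≢ 2≤M p) , rel-beside b (proj₁ distinct) , rel-beside b (proj₂ distinct)
    where distinct = secondOtherThan-≢ (≤ᵇ⇒≤ 3 M (triangle-M>2 L>2 M>2 t)) p
  pairFor-rel 2≤L _   (b , p) 2F 0F _ =
    rel-away p p (otherThan-≢ 2≤L b) , rel-away p p (otherThan-≢ 2≤L b) , rel-refl (otherThan b , p)
  pairFor-rel 2≤L 2≤M (b , p) 2F 1F _ =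
    rel-away p p (otherThan-≢ 2≤L b) , rel-away p (otherThan p) (otherThan-≢ 2≤L b) , rel-beside (otherThan b) (otherThan-≢ 2≤M p)
  pairFor-rel 2≤L _   (b , p) 2F 2F t =
    rel-away p p (otherThan-≢ 2≤L b) , rel-away p p (proj₁ distinct) , rel-away p p (proj₂ distinct)
    where distinct = secondOtherThan-≢ (≤ᵇ⇒≤ 3 L (triangle-L>2 L>2 M>2 t)) b

module Scheme {c ℓ} (F : Field c ℓ) (n : ℕ) (ls ms : Fin n → ℕ) where
  open import Data.Bool using (Bool; true; false; _∧_; T)
  import Data.Bool.Properties as Bool
  open import Data.Fin using (zero; suc)
  open import Data.Fin.Properties using (all?; _≟_)
  open import Data.Fin.Subset using (Subset; _∩_)
  open import Data.List using (List; []; _∷_; map; filter; allFin; cartesianProduct)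
  import Data.Nat as ℕ
  open import Data.Nat.Properties using (+-*-commutativeSemiring)
  open import Data.Product using (Σ-syntax; _×_; _,_; proj₁; proj₂)
  open import Data.Product.Function.NonDependent.Propositional using (_×-⇔_)
  open import Data.Vec using (lookup; tabulate)
  open import Data.Vec.Properties using (lookup∘tabulate; lookup-zipWith)
  open import Function using (_∘_; _⇔_; mk⇔; flip; Equivalence)
  import Function.Properties.Equivalence as ⇔
  open import Relation.Binary using (Setoid; IsEquivalence)
  import Relation.Binary.Reasoning.Setoid as SetoidReasoning
  open import Relation.Binary.PropositionalEquality as ≡ using (_≡_)
  open import Relation.Nullary using (Dec; yes; no; does)
  open import Relation.Nullary.Decidable using (does-⇔; T?; toWitness)
  open SingleCoordinate
  open FinFacts using (T-does; ∀-T-∧; ⊆-lookup)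
  open Triples n

  open Field F hiding (zero)
  open Setup F n ls ms
  open FiniteSums commutativeSemiring
  module ℕ∑ = FiniteSums +-*-commutativeSemiring
  module *-CS = Algebra.Properties.CommutativeSemigroup *-commutativeSemigroup
  module Blk (i : Fin n) = Blocks (ls i) (ms i)

  rel-blocks : ∀ {i} (u v : U i) → rel u v ≡ Blk.rel i u v
  rel-blocks (b , p) (b′ , p′) with b ≟ b′ | p ≟ p′
  ... | yes _ | yes _ = ≡.refl
  ... | yes _ | no  _ = ≡.refl
  ... | no  _ | _     = ≡.refl

  _≐_ : X → X → Set
  y ≐ z = ∀ i → y i ≡ z i

  ≐-sym : ∀ {y z} → y ≐ z → z ≐ y
  ≐-sym e i = ≡.sym (e i)

  allX-enumerates : Enumerates _≟X_ allX
  allX-enumerates = allDep-enumerates n U _ (λ i → _≟U_) λ i →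
    Enumerates-⇔ (_≟×_ _≟_ _≟_) (cartesianProduct-enumerates _≟_ _≟_ (allFin-enumerates (ls i)) (allFin-enumerates (ms i)))
                 _≟U_ (mk⇔ (λ (e₁ , e₂) → ≡.cong₂ _,_ e₁ e₂) (λ { ≡.refl → ≡.refl , ≡.refl }))

  allX-enumerates′ : Enumerates (flip _≟X_) allX
  allX-enumerates′ = Enumerates-⇔ _≟X_ allX-enumerates (flip _≟X_) (mk⇔ ≐-sym ≐-sym)

  allE-enumerates : Enumerates (λ a b → all? (λ i → b i ≟ a i)) (allE n)
  allE-enumerates = allDep-enumerates n (λ _ → Fin 3) (λ _ → allFin 3) (λ _ → flip _≟_)
    (λ _ → Enumerates-⇔ _≟_ (allFin-enumerates 3) (flip _≟_) (mk⇔ ≡.sym ≡.sym))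

  allTriples-enumerates : Enumerates _≟₃_ (allTriples n)
  allTriples-enumerates =
    Enumerates-⇔ (_≟×_ _≟ˢ_ (_≟×_ _≟ˢ_ _≟ˢ_))
      (cartesianProduct-enumerates _≟ˢ_ (_≟×_ _≟ˢ_ _≟ˢ_) (allSubsets-enumerates n)
        (cartesianProduct-enumerates _≟ˢ_ _≟ˢ_ (allSubsets-enumerates n) (allSubsets-enumerates n)))
      _≟₃_ (mk⇔ (λ (e₁ , e₂ , e₃) → ≡.cong₂ _,_ e₁ (≡.cong₂ _,_ e₂ e₃)) (λ { ≡.refl → ≡.refl , ≡.refl , ≡.refl }))

  ≈M-isEquivalence : IsEquivalence _≈M_
  ≈M-isEquivalence = record
    { refl  = λ _ _ → refl
    ; sym   = λ e y z → sym (e y z)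
    ; trans = λ e e′ y z → trans (e y z) (e′ y z)
    }

  Mat-setoid : Setoid c ℓ
  Mat-setoid = record { isEquivalence = ≈M-isEquivalence }

  module ≈M-Reasoning = SetoidReasoning Mat-setoid
  open IsEquivalence ≈M-isEquivalence using () renaming (refl to ≈M-refl; sym to ≈M-sym)

  *M-cong : ∀ {M M′ N N′} → M ≈M M′ → N ≈M N′ → (M *M N) ≈M (M′ *M N′)
  *M-cong eM eN y z = ∑-cong allX (λ w → *-cong (eM y w) (eN w z))

  *M-assoc : ∀ M N Q → ((M *M N) *M Q) ≈M (M *M (N *M Q))
  *M-assoc M N Q y z = begin
    ∑[ v ∈ allX ] (∑[ w ∈ allX ] (M y w * N w v) * Q v z) ≈⟨ ∑-cong allX (λ v → ∑-*ʳ allX (Q v z) _) ⟨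
    ∑[ v ∈ allX ] ∑[ w ∈ allX ] (M y w * N w v * Q v z)   ≈⟨ ∑-comm allX allX _ ⟩
    ∑[ w ∈ allX ] ∑[ v ∈ allX ] (M y w * N w v * Q v z)   ≈⟨ ∑-cong allX (λ w → ∑-cong allX (λ v → *-assoc _ _ _)) ⟩
    ∑[ w ∈ allX ] ∑[ v ∈ allX ] (M y w * (N w v * Q v z)) ≈⟨ ∑-cong allX (λ w → ∑-*ˡ allX (M y w) _) ⟩
    ∑[ w ∈ allX ] (M y w * ∑[ v ∈ allX ] (N w v * Q v z)) ∎
    where open SetoidReasoning setoid

  *M-distribˡ : ∀ M N Q → (M *M (N +M Q)) ≈M ((M *M N) +M (M *M Q))
  *M-distribˡ M N Q y z = trans (∑-cong allX (λ w → distribˡ (M y w) (N w z) (Q w z))) (∑-+ allX _ _)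

  *M-distribʳ : ∀ M N Q → ((M +M N) *M Q) ≈M ((M *M Q) +M (N *M Q))
  *M-distribʳ M N Q y z = trans (∑-cong allX (λ w → distribʳ (Q w z) (M y w) (N y w))) (∑-+ allX _ _)

  *M-·ˡ : ∀ a M N → ((a ·M M) *M N) ≈M (a ·M (M *M N))
  *M-·ˡ a M N y z = trans (∑-cong allX (λ w → *-assoc a (M y w) (N w z))) (∑-*ˡ allX a _)

  *M-·ʳ : ∀ a M N → (M *M (a ·M N)) ≈M (a ·M (M *M N))
  *M-·ʳ a M N y z = trans (∑-cong allX (λ w → *-CS.x∙yz≈y∙xz (M y w) a (N w z))) (∑-*ˡ allX a _)

  sumM-apply : ∀ Ms y z → sumM Ms y z ≡ ∑[ M ∈ Ms ] M y z
  sumM-apply []       y z = ≡.refl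
  sumM-apply (M ∷ Ms) y z = ≡.cong (M y z +_) (sumM-apply Ms y z)

  ι-+ : ∀ a b → ι (a ℕ.+ b) ≈ ι a + ι b
  ι-+ ℕ.zero    b = sym (+-identityˡ _)
  ι-+ (ℕ.suc a) b = trans (+-congˡ (ι-+ a b)) (sym (+-assoc _ _ _))

  ι-* : ∀ a b → ι (a ℕ.* b) ≈ ι a * ι b
  ι-* ℕ.zero    b = sym (zeroˡ _)
  ι-* (ℕ.suc a) b = trans (ι-+ b (a ℕ.* b)) (trans (+-cong (sym (*-identityˡ _)) (ι-* a b)) (sym (distribʳ _ _ _)))

  ι-⟦⟧ : ∀ b → ι ℕ∑.⟦ b ⟧ ≈ ⟦ b ⟧
  ι-⟦⟧ true  = +-identityʳ 1#
  ι-⟦⟧ false = refl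

  ι-∑ : ∀ {A : Set} (xs : List A) (f : A → ℕ) → ι (ℕ∑.∑ xs f) ≈ ∑[ z ∈ xs ] ι (f z)
  ι-∑ []       f = refl
  ι-∑ (z ∷ xs) f = trans (ι-+ (f z) _) (+-congˡ (ι-∑ xs f))

  ι-prodFin : ∀ {m} (f : Fin m → ℕ) → ι (prodFin f) ≈ ∏ (ι ∘ f)
  ι-prodFin {ℕ.zero}  f = +-identityʳ 1#
  ι-prodFin {ℕ.suc m} f = trans (ι-* (f zero) _) (*-congˡ (ι-prodFin (f ∘ suc)))

  ∧-regroup : ∀ a b c d e → ((a ∧ b) ∧ c) ∧ ((b ∧ d) ∧ e) ≡ (a ∧ d) ∧ (b ∧ c ∧ e)
  ∧-regroup = toWitness {a? = ∀ᵇ? λ a → ∀ᵇ? λ b → ∀ᵇ? λ c → ∀ᵇ? λ d → ∀ᵇ? λ e →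
    (((a ∧ b) ∧ c) ∧ ((b ∧ d) ∧ e)) Bool.≟ ((a ∧ d) ∧ (b ∧ c ∧ e))} _

  module Closure (x : X) (g : E n) where
    open Based x
    open ≈M-Reasoning

    InETE⇒InT : ∀ N → InETE g N → InT N
    InETE⇒InT N (M , M∈T , N≈EME) = resp (≈M-sym N≈EME) (mul (mul (genE g) M∈T) (genE g))

    InETE-+ : ∀ M N → InETE g M → InETE g N → InETE g (M +M N)
    InETE-+ M N (P , P∈T , M≈EPE) (Q , Q∈T , N≈EQE) = P +M Q , add P∈T Q∈T , (begin
      M +M N                                          ≈⟨ (λ y z → +-cong (M≈EPE y z) (N≈EQE y z)) ⟩
      ((Es g *M P) *M Es g) +M ((Es g *M Q) *M Es g)  ≈⟨ *M-distribʳ (Es g *M P) (Es g *M Q) (Es g) ⟨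
      ((Es g *M P) +M (Es g *M Q)) *M Es g            ≈⟨ *M-cong (*M-distribˡ (Es g) P Q) ≈M-refl ⟨
      (Es g *M (P +M Q)) *M Es g                      ∎)

    InETE-· : ∀ a M → InETE g M → InETE g (a ·M M)
    InETE-· a M (P , P∈T , M≈EPE) = a ·M P , scal a P∈T , (begin
      a ·M M                          ≈⟨ (λ y z → *-congˡ (M≈EPE y z)) ⟩
      a ·M ((Es g *M P) *M Es g)      ≈⟨ *M-·ˡ a (Es g *M P) (Es g) ⟨
      (a ·M (Es g *M P)) *M Es g      ≈⟨ *M-cong (*M-·ʳ a (Es g) P) ≈M-refl ⟨
      (Es g *M (a ·M P)) *M Es g      ∎)

    InETE-* : ∀ M N → InETE g M → InETE g N → InETE g (M *M N)
    InETE-* M N (P , P∈T , M≈EPE) (Q , Q∈T , N≈EQE) = (P *M 𝔼) *M (𝔼 *M Q) , mul (mul P∈T (genE g)) (mul (genE g) Q∈T) , (begin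
      M *M N                                  ≈⟨ *M-cong M≈EPE N≈EQE ⟩
      ((𝔼 *M P) *M 𝔼) *M ((𝔼 *M Q) *M 𝔼)      ≈⟨ *M-assoc ((𝔼 *M P) *M 𝔼) (𝔼 *M Q) 𝔼 ⟨
      (((𝔼 *M P) *M 𝔼) *M (𝔼 *M Q)) *M 𝔼      ≈⟨ *M-cong (*M-cong (*M-assoc 𝔼 P 𝔼) ≈M-refl) ≈M-refl ⟩
      ((𝔼 *M (P *M 𝔼)) *M (𝔼 *M Q)) *M 𝔼      ≈⟨ *M-cong (*M-assoc 𝔼 (P *M 𝔼) (𝔼 *M Q)) ≈M-refl ⟩
      (𝔼 *M ((P *M 𝔼) *M (𝔼 *M Q))) *M 𝔼      ∎)
      where 𝔼 = Es g

  module Shell (x : X) (g : E n) where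
    open Based x
    open Closure x g
    open SetoidReasoning setoid

    module Coord (i : Fin n) = Coordinate (Blk.L>2 i) (Blk.M>2 i) (g i)
    open Coord using (admissible; allows; typeOf; realise)

    relv : X → X → E n
    relv y z i = rel (y i) (z i)

    inShell : X → Bool
    inShell y = does (InR? g x y)

    inShell-coordinates : ∀ y → T (inShell y) → ∀ i → Blk.rel i (x i) (y i) ≡ g i
    inShell-coordinates y t i = ≡.trans (≡.sym (rel-blocks (x i) (y i))) (T-does (InR? g x y) .Equivalence.to t i)

    lookup-S : ∀ j (a : E n) i → lookup (S j a) i ≡ a i == j
    lookup-S j a i = lookup∘tabulate _ i

    lookup-S∩ : ∀ j (a : E n) (p : Subset n) {f : Fin n → Bool} → (∀ i → lookup p i ≡ f i) →
                ∀ i → lookup (S j a ∩ p) i ≡ (a i == j ∧ f i)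
    lookup-S∩ j a p p≡f i = ≡.trans (lookup-zipWith _∧_ i (S j a) p) (≡.cong₂ _∧_ (lookup-S j a i) (p≡f i))

    lookup-S∩S : ∀ j i → lookup (S j g ∩ S j g) i ≡ g i == j
    lookup-S∩S j i = ≡.trans (lookup-S∩ j g (S j g) (lookup-S j g) i) (Bool.∧-idem _)

    lookup-S₁° : ∀ i → lookup (circ (S r1 g ∩ S r1 g)) i ≡ Coord.S₁° i
    lookup-S₁° i = ≡.trans (lookup∘tabulate _ i) (≡.cong (_∧ Blk.M>2 i) (lookup-S∩S r1 i))

    lookup-S₂• : ∀ i → lookup (bul (S r2 g ∩ S r2 g)) i ≡ Coord.S₂• i
    lookup-S₂• i = ≡.trans (lookup∘tabulate _ i) (≡.cong (_∧ Blk.L>2 i) (lookup-S∩S r2 i))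

    BCond⇔ : ∀ τ a → BCond g g τ a ⇔ (∀ i → T (allows i (τ ‼ i) (a i)))
    BCond⇔ (J₁ , J₂ , J₃) a = ⇔.trans
      (⊆-lookup (lookup-S∩ r1 a _ lookup-S₁°) (λ _ → ≡.refl) ×-⇔
       ⊆-lookup (lookup-S∩ r2 a _ lookup-S₂•) (λ _ → ≡.refl) ×-⇔
       ⊆-lookup (lookup-S∩ r1 a _ (lookup-S∩S r2)) (λ _ → ≡.refl))
      (⇔.trans (⇔.refl ×-⇔ ∀-T-∧) ∀-T-∧)

    InU⇔ : ∀ τ → InU g g τ ⇔ (∀ i → T (admissible i (τ ‼ i)))
    InU⇔ (J₁ , J₂ , J₃) = ⇔.trans
      (⊆-lookup (λ _ → ≡.refl) lookup-S₁° ×-⇔ ⊆-lookup (λ _ → ≡.refl) lookup-S₂• ×-⇔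
       ⊆-lookup (λ _ → ≡.refl) (λ _ → ≡.refl) ×-⇔ ⊆-lookup (λ _ → ≡.refl) (lookup-S∩S r2))
      (⇔.trans (⇔.refl ×-⇔ ⇔.refl ×-⇔ ∀-T-∧) (⇔.trans (⇔.refl ×-⇔ ∀-T-∧) ∀-T-∧))

    BCond?-resp : ∀ τ {a b : E n} → (∀ i → b i ≡ a i) → does (BCond? g g τ a) ≡ does (BCond? g g τ b)
    BCond?-resp τ {a} {b} b≐a = does-⇔ (⇔.trans (BCond⇔ τ a) (⇔.trans coordinates (⇔.sym (BCond⇔ τ b))))
                                        (BCond? g g τ a) (BCond? g g τ b)
      where
      coordinates : (∀ i → T (allows i (τ ‼ i) (a i))) ⇔ (∀ i → T (allows i (τ ‼ i) (b i)))
      coordinates = mk⇔ (λ h i → ≡.subst (T ∘ allows i (τ ‼ i)) (≡.sym (b≐a i)) (h i))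
                        (λ h i → ≡.subst (T ∘ allows i (τ ‼ i)) (b≐a i) (h i))

    Respects≐ : Mat → Set ℓ
    Respects≐ M = ∀ {y y′ z z′} → y ≐ y′ → z ≐ z′ → M y z ≈ M y′ z′

    InR?-resp : ∀ a {y y′ z z′} → y ≐ y′ → z ≐ z′ → does (InR? a y z) ≡ does (InR? a y′ z′)
    InR?-resp a y≐y′ z≐z′ = does-⇔ (mk⇔ (moved y≐y′ z≐z′) (moved (≐-sym y≐y′) (≐-sym z≐z′))) (InR? a _ _) (InR? a _ _)
      where
      moved : ∀ {y y′ z z′} → y ≐ y′ → z ≐ z′ → InR a y z → InR a y′ z′
      moved y≐y′ z≐z′ r i = ≡.trans (≡.cong₂ rel (≡.sym (y≐y′ i)) (≡.sym (z≐z′ i))) (r i)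

    inShell-resp : ∀ {y y′} → y ≐ y′ → inShell y ≡ inShell y′
    inShell-resp = InR?-resp g (λ _ → ≡.refl)

    A-resp : ∀ a → Respects≐ (A a)
    A-resp a y≐y′ z≐z′ = reflexive (≡.cong ⟦_⟧ (InR?-resp a y≐y′ z≐z′))

    Es-*M : ∀ M → Respects≐ M → ∀ y z → (Es g *M M) y z ≈ ⟦ inShell y ⟧ * M y z
    Es-*M M M-resp y z = begin
      ∑[ w ∈ allX ] (⟦ does (y ≟X w) ∧ inShell y ⟧ * M w z)
        ≈⟨ ∑-cong allX (λ w → trans (*-congʳ (⟦⟧-∧ _ _)) (*-assoc _ _ _)) ⟩
      ∑[ w ∈ allX ] (⟦ does (y ≟X w) ⟧ * (⟦ inShell y ⟧ * M w z))
        ≈⟨ ∑-pick (flip _≟X_) allX-enumerates′ y _ (λ w y≐w → *-congˡ (M-resp (≐-sym y≐w) (λ _ → ≡.refl))) ⟩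
      ⟦ inShell y ⟧ * M y z ∎

    *M-Es : ∀ M → Respects≐ M → ∀ y z → (M *M Es g) y z ≈ M y z * ⟦ inShell z ⟧
    *M-Es M M-resp y z = begin
      ∑[ w ∈ allX ] (M y w * ⟦ does (w ≟X z) ∧ inShell w ⟧)
        ≈⟨ ∑-cong allX (λ w → trans (*-congˡ (⟦⟧-∧ _ _)) (*-CS.x∙yz≈y∙xz _ _ _)) ⟩
      ∑[ w ∈ allX ] (⟦ does (w ≟X z) ⟧ * (M y w * ⟦ inShell w ⟧))
        ≈⟨ ∑-pick _≟X_ allX-enumerates z _ (λ w w≐z →
             *-cong (M-resp (λ _ → ≡.refl) w≐z) (reflexive (≡.cong ⟦_⟧ (inShell-resp w≐z)))) ⟩
      M y z * ⟦ inShell z ⟧ ∎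

    Es-sandwich : ∀ M → Respects≐ M → ∀ y z → ((Es g *M M) *M Es g) y z ≈ ⟦ inShell y ∧ inShell z ⟧ * M y z
    Es-sandwich M M-resp y z = begin
      ((Es g *M M) *M Es g) y z              ≈⟨ *M-Es (Es g *M M) EM-resp y z ⟩
      (Es g *M M) y z * ⟦ inShell z ⟧        ≈⟨ *-congʳ (Es-*M M M-resp y z) ⟩
      ⟦ inShell y ⟧ * M y z * ⟦ inShell z ⟧  ≈⟨ *-CS.xy∙z≈xz∙y _ _ _ ⟩
      ⟦ inShell y ⟧ * ⟦ inShell z ⟧ * M y z  ≈⟨ *-congʳ (⟦⟧-∧ (inShell y) (inShell z)) ⟨
      ⟦ inShell y ∧ inShell z ⟧ * M y z      ∎
      where
      EM-resp : Respects≐ (Es g *M M)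
      EM-resp {y} {y′} {z} {z′} y≐y′ z≐z′ = trans (Es-*M M M-resp y z)
        (trans (*-cong (reflexive (≡.cong ⟦_⟧ (inShell-resp y≐y′))) (M-resp y≐y′ z≐z′)) (sym (Es-*M M M-resp y′ z′)))

    B-indicator : ∀ τ y z → B g g τ y z ≈ ⟦ inShell y ∧ inShell z ⟧ * ⟦ does (BCond? g g τ (relv y z)) ⟧
    B-indicator τ y z = begin
      B g g τ y z
        ≡⟨ ≡.trans (sumM-apply (map EAE terms) y z) (∑-map EAE terms (λ M → M y z)) ⟩
      ∑[ a ∈ terms ] EAE a y z
        ≈⟨ ∑-filter (BCond? g g τ) (allE n) _ ⟩
      ∑[ a ∈ allE n ] (⟦ does (BCond? g g τ a) ⟧ * EAE a y z)
        ≈⟨ ∑-cong (allE n) (λ a → trans (*-congˡ (Es-sandwich (A a) (A-resp a) y z)) (*-CS.x∙yz≈z∙xy _ _ _)) ⟩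
      ∑[ a ∈ allE n ] (⟦ does (InR? a y z) ⟧ * (⟦ does (BCond? g g τ a) ⟧ * ⟦ inShell y ∧ inShell z ⟧))
        ≈⟨ ∑-pick _ allE-enumerates (relv y z) _ (λ a a≐yz → *-congʳ (reflexive (≡.cong ⟦_⟧ (BCond?-resp τ a≐yz)))) ⟩
      ⟦ does (BCond? g g τ (relv y z)) ⟧ * ⟦ inShell y ∧ inShell z ⟧
        ≈⟨ *-comm _ _ ⟩
      ⟦ inShell y ∧ inShell z ⟧ * ⟦ does (BCond? g g τ (relv y z)) ⟧ ∎
      where
      EAE : E n → Mat
      EAE a = (Es g *M A a) *M Es g
      terms = filter (BCond? g g τ) (allE n)

    B-resp : ∀ τ → Respects≐ (B g g τ)
    B-resp τ {y} {y′} {z} {z′} y≐y′ z≐z′ = trans (B-indicator τ y z) (trans (reflexive (≡.cong₂ (λ s b → ⟦ s ⟧ * ⟦ b ⟧)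
      (≡.cong₂ _∧_ (inShell-resp y≐y′) (inShell-resp z≐z′))
      (BCond?-resp τ (λ i → ≡.cong₂ rel (≡.sym (y≐y′ i)) (≡.sym (z≐z′ i)))))) (sym (B-indicator τ y′ z′)))

    -- Coordinate i of the condition on w in (B_τ B_σ)(y,z) = ∑_w B_τ(y,w) B_σ(w,z).
    middle : Triple n → Triple n → X → X → (i : Fin n) → U i → Bool
    middle τ σ y z i u = rel (x i) u == g i ∧ allows i (τ ‼ i) (rel (y i) u) ∧ allows i (σ ‼ i) (rel u (z i))

    middle-all? : ∀ τ σ y z w → (inShell w ∧ does (BCond? g g τ (relv y w)) ∧ does (BCond? g g σ (relv w z))) ≡
                                does (all? (λ i → T? (middle τ σ y z i (w i))))
    middle-all? τ σ y z w =
      does-⇔ (⇔.trans (⇔.trans Bool.T-∧ (⇔.refl ×-⇔ Bool.T-∧))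
               (⇔.trans (shell ×-⇔ ⇔.trans (T-does (BCond? g g τ (relv y w))) (BCond⇔ τ (relv y w)) ×-⇔
                                   ⇔.trans (T-does (BCond? g g σ (relv w z))) (BCond⇔ σ (relv w z)))
                        (⇔.trans (⇔.refl ×-⇔ ∀-T-∧) ∀-T-∧)))
             (T? _) (all? (λ i → T? (middle τ σ y z i (w i))))
      where
      shell : T (inShell w) ⇔ (∀ i → T (rel (x i) (w i) == g i))
      shell = ⇔.trans (T-does (InR? g x w)) (mk⇔ (λ r i → T-does (_ ≟ _) .Equivalence.from (r i))
                                                  (λ t i → T-does (_ ≟ _) .Equivalence.to (t i)))

    module _ (τ σ : Triple n) (τ∈𝒰 : InU g g τ) (σ∈𝒰 : InU g g σ) (y z : X) (y∈ : T (inShell y)) (z∈ : T (inShell z)) where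

      middles-at : ∀ i → ∑[ u ∈ cartesianProduct (allFin (ls i)) (allFin (ms i)) ] ⟦ middle τ σ y z i u ⟧ ≈
                         ι (Blk.valency i ((τ ‼ i) ∧ᶠ (σ ‼ i))) * ⟦ allows i ((τ ‼ i) ∨ᶠ (σ ‼ i)) (rel (y i) (z i)) ⟧
      middles-at i = begin
        ∑[ u ∈ points ] ⟦ middle τ σ y z i u ⟧                ≈⟨ ∑-cong points (λ u → sym (ι-⟦⟧ _)) ⟩
        ∑[ u ∈ points ] ι ℕ∑.⟦ middle τ σ y z i u ⟧           ≈⟨ ι-∑ points _ ⟨
        ι (ℕ∑.∑ points (λ u → ℕ∑.⟦ middle τ σ y z i u ⟧))     ≡⟨ ≡.cong ι count ⟩
        ι (valency ℕ.* ℕ∑.⟦ union ⟧)                          ≈⟨ ι-* valency _ ⟩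
        ι valency * ι ℕ∑.⟦ union ⟧                            ≈⟨ *-congˡ (ι-⟦⟧ union) ⟩
        ι valency * ⟦ union ⟧                                 ∎
        where
        points = cartesianProduct (allFin (ls i)) (allFin (ms i))
        valency = Blk.valency i ((τ ‼ i) ∧ᶠ (σ ‼ i))
        union = allows i ((τ ‼ i) ∨ᶠ (σ ‼ i)) (rel (y i) (z i))
        count : ℕ∑.∑ points (λ u → ℕ∑.⟦ middle τ σ y z i u ⟧) ≡ valency ℕ.* ℕ∑.⟦ union ⟧
        count rewrite rel-blocks (y i) (z i) = ≡.trans
          (ℕ∑.∑-cong points (λ u → ≡.cong ℕ∑.⟦_⟧ (≡.cong₂ _∧_ (≡.cong (_== g i) (rel-blocks (x i) u))
            (≡.cong₂ _∧_ (≡.cong (allows i (τ ‼ i)) (rel-blocks (y i) u)) (≡.cong (allows i (σ ‼ i)) (rel-blocks u (z i)))))))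
          (Blk.coordinate-count i (g i) (x i) (y i) (z i) (inShell-coordinates y y∈ i) (inShell-coordinates z z∈ i)
            (τ ‼ i) (InU⇔ τ .Equivalence.to τ∈𝒰 i) (σ ‼ i) (InU⇔ σ .Equivalence.to σ∈𝒰 i))

      middles : ∑[ w ∈ allX ] ⟦ does (all? (λ i → T? (middle τ σ y z i (w i)))) ⟧ ≈
                ι (k (τ ∩₃ σ)) * ⟦ does (BCond? g g (τ ∪₃ σ) (relv y z)) ⟧
      middles = begin
        ∑[ w ∈ allX ] ⟦ does (all? (λ i → T? (middle τ σ y z i (w i)))) ⟧
          ≈⟨ ∑-cong allX (λ w → ⟦all?⟧ (λ i → T? (middle τ σ y z i (w i)))) ⟩
        ∑[ w ∈ allX ] ∏ (λ i → ⟦ middle τ σ y z i (w i) ⟧)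
          ≈⟨ ∑-allDep-∏ n U _ (λ i u → ⟦ middle τ σ y z i u ⟧) ⟩
        ∏ (λ i → ∑[ u ∈ cartesianProduct (allFin (ls i)) (allFin (ms i)) ] ⟦ middle τ σ y z i u ⟧)
          ≈⟨ ∏-cong middles-at ⟩
        ∏ (λ i → valency i * union i)
          ≈⟨ ∏-* valency union ⟩
        ∏ valency * ∏ union
          ≈⟨ *-cong valencies unions ⟩
        ι (k (τ ∩₃ σ)) * ⟦ does (BCond? g g (τ ∪₃ σ) (relv y z)) ⟧ ∎
        where
        valency union : Fin n → Carrier
        valency i = ι (Blk.valency i ((τ ‼ i) ∧ᶠ (σ ‼ i)))
        union   i = ⟦ allows i ((τ ‼ i) ∨ᶠ (σ ‼ i)) (rel (y i) (z i)) ⟧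

        valencies : ∏ valency ≈ ι (k (τ ∩₃ σ))
        valencies = sym (trans (ι-prodFin (λ i → Blk.valency i ((τ ∩₃ σ) ‼ i)))
                               (∏-cong (λ i → reflexive (≡.cong (ι ∘ Blk.valency i) (‼-∩ τ σ i)))))

        unions : ∏ union ≈ ⟦ does (BCond? g g (τ ∪₃ σ) (relv y z)) ⟧
        unions = begin
          ∏ union
            ≈⟨ ∏-cong (λ i → reflexive (≡.cong (λ j → ⟦ allows i j (rel (y i) (z i)) ⟧) (≡.sym (‼-∪ τ σ i)))) ⟩
          ∏ (λ i → ⟦ allows i ((τ ∪₃ σ) ‼ i) (relv y z i) ⟧)
            ≈⟨ ⟦all?⟧ (λ i → T? (allows i ((τ ∪₃ σ) ‼ i) (relv y z i))) ⟨
          ⟦ does (all? (λ i → T? (allows i ((τ ∪₃ σ) ‼ i) (relv y z i)))) ⟧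
            ≡⟨ ≡.cong ⟦_⟧ (does-⇔ (⇔.sym (BCond⇔ (τ ∪₃ σ) (relv y z))) (all? _) (BCond? g g (τ ∪₃ σ) (relv y z))) ⟩
          ⟦ does (BCond? g g (τ ∪₃ σ) (relv y z)) ⟧ ∎

    B-*-B : ∀ τ σ → InU g g τ → InU g g σ → (B g g τ *M B g g σ) ≈M (ι (k (τ ∩₃ σ)) ·M B g g (τ ∪₃ σ))
    B-*-B τ σ τ∈𝒰 σ∈𝒰 y z = begin
      ∑[ w ∈ allX ] (B g g τ y w * B g g σ w z)
        ≈⟨ ∑-cong allX (λ w → trans (*-cong (B-indicator τ y w) (B-indicator σ w z)) (split w)) ⟩
      ∑[ w ∈ allX ] (⟦ inShell y ∧ inShell z ⟧ * ⟦ middle? w ⟧)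
        ≈⟨ ∑-*ˡ allX _ _ ⟩
      ⟦ inShell y ∧ inShell z ⟧ * ∑[ w ∈ allX ] ⟦ middle? w ⟧
        ≈⟨ ⟦⟧-*-cong (inShell y ∧ inShell z) count ⟩
      ⟦ inShell y ∧ inShell z ⟧ * (ι (k (τ ∩₃ σ)) * ⟦ does (BCond? g g (τ ∪₃ σ) (relv y z)) ⟧)
        ≈⟨ *-CS.x∙yz≈y∙xz _ _ _ ⟩
      ι (k (τ ∩₃ σ)) * (⟦ inShell y ∧ inShell z ⟧ * ⟦ does (BCond? g g (τ ∪₃ σ) (relv y z)) ⟧)
        ≈⟨ *-congˡ (B-indicator (τ ∪₃ σ) y z) ⟨
      ι (k (τ ∩₃ σ)) * B g g (τ ∪₃ σ) y z ∎
      where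
      middle? : X → Bool
      middle? w = inShell w ∧ does (BCond? g g τ (relv y w)) ∧ does (BCond? g g σ (relv w z))

      split : ∀ w → (⟦ inShell y ∧ inShell w ⟧ * ⟦ does (BCond? g g τ (relv y w)) ⟧) *
                    (⟦ inShell w ∧ inShell z ⟧ * ⟦ does (BCond? g g σ (relv w z)) ⟧) ≈ ⟦ inShell y ∧ inShell z ⟧ * ⟦ middle? w ⟧
      split w = begin
        (⟦ inShell y ∧ inShell w ⟧ * ⟦ does (BCond? g g τ (relv y w)) ⟧) * (⟦ inShell w ∧ inShell z ⟧ * ⟦ does (BCond? g g σ (relv w z)) ⟧)
          ≈⟨ *-cong (⟦⟧-∧ _ _) (⟦⟧-∧ _ _) ⟨
        ⟦ (inShell y ∧ inShell w) ∧ does (BCond? g g τ (relv y w)) ⟧ * ⟦ (inShell w ∧ inShell z) ∧ does (BCond? g g σ (relv w z)) ⟧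
          ≈⟨ ⟦⟧-∧ _ _ ⟨
        ⟦ ((inShell y ∧ inShell w) ∧ does (BCond? g g τ (relv y w))) ∧ ((inShell w ∧ inShell z) ∧ does (BCond? g g σ (relv w z))) ⟧
          ≡⟨ ≡.cong ⟦_⟧ (∧-regroup (inShell y) (inShell w) _ (inShell z) _) ⟩
        ⟦ (inShell y ∧ inShell z) ∧ middle? w ⟧
          ≈⟨ ⟦⟧-∧ _ _ ⟩
        ⟦ inShell y ∧ inShell z ⟧ * ⟦ middle? w ⟧ ∎

      count : T (inShell y ∧ inShell z) → ∑[ w ∈ allX ] ⟦ middle? w ⟧ ≈ ι (k (τ ∩₃ σ)) * ⟦ does (BCond? g g (τ ∪₃ σ) (relv y z)) ⟧
      count t = trans (∑-cong allX (λ w → reflexive (≡.cong ⟦_⟧ (middle-all? τ σ y z w))))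
                      (middles τ σ τ∈𝒰 σ∈𝒰 y z (proj₁ (Bool.T-∧ .Equivalence.to t)) (proj₂ (Bool.T-∧ .Equivalence.to t)))

    B∈ETE : ∀ τ → InETE g (B g g τ)
    B∈ETE τ = B g g τ , B∈T (filter (BCond? g g τ) (allE n)) , λ y z → begin
      B g g τ y z                                                      ≈⟨ B-indicator τ y z ⟩
      ⟦ inShell y ∧ inShell z ⟧ * ⟦ does (BCond? g g τ (relv y z)) ⟧   ≈⟨ ⟦⟧-idem (inShell y ∧ inShell z) _ ⟨
      ⟦ inShell y ∧ inShell z ⟧ * (⟦ inShell y ∧ inShell z ⟧ * ⟦ does (BCond? g g τ (relv y z)) ⟧)
                                                                        ≈⟨ *-congˡ (B-indicator τ y z) ⟨
      ⟦ inShell y ∧ inShell z ⟧ * B g g τ y z                           ≈⟨ Es-sandwich (B g g τ) (B-resp τ) y z ⟨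
      ((Es g *M B g g τ) *M Es g) y z                                   ∎
      where
      B∈T : ∀ as → InT (sumM (map (λ a → (Es g *M A a) *M Es g) as))
      B∈T []       = resp (λ _ _ → zeroˡ _) (scal 0# (genA g))
      B∈T (a ∷ as) = add (mul (mul (genE g) (genA a)) (genE g)) (B∈T as)

    Stabiliser : Set
    Stabiliser = (i : Fin n) → Σ[ π ∈ Blk.Automorphism i ] Blk.to π (x i) ≡ x i

    act act⁻¹ : Stabiliser → X → X
    act   π y i = Blk.to   (proj₁ (π i)) (y i)
    act⁻¹ π y i = Blk.from (proj₁ (π i)) (y i)

    rel-act : ∀ π y z i → rel (act π y i) (act π z i) ≡ rel (y i) (z i)
    rel-act π y z i = ≡.trans (rel-blocks _ _) (≡.trans (Blk.rel-to (proj₁ (π i)) (y i) (z i)) (≡.sym (rel-blocks _ _)))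

    rel-x-act : ∀ π y i → rel (x i) (act π y i) ≡ rel (x i) (y i)
    rel-x-act π y i = ≡.trans (≡.cong (λ u → rel u (act π y i)) (≡.sym (proj₂ (π i)))) (rel-act π x y i)

    act-inverse : ∀ π {v w} → v ≐ act π w ⇔ w ≐ act⁻¹ π v
    act-inverse π = mk⇔ (λ e i → ≡.trans (≡.sym (Blk.from-to (proj₁ (π i)) _)) (≡.cong (Blk.from (proj₁ (π i))) (≡.sym (e i))))
                        (λ e i → ≡.trans (≡.sym (Blk.to-from (proj₁ (π i)) _)) (≡.cong (Blk.to (proj₁ (π i))) (≡.sym (e i))))

    act-≐ : ∀ π {y z} → act π y ≐ act π z ⇔ y ≐ z
    act-≐ π = mk⇔ (λ e i → ≡.trans (≡.sym (Blk.from-to (proj₁ (π i)) _))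
                                   (≡.trans (≡.cong (Blk.from (proj₁ (π i))) (e i)) (Blk.from-to (proj₁ (π i)) _)))
                  (λ e i → ≡.cong (Blk.to (proj₁ (π i))) (e i))

    Invariant : Mat → Set ℓ
    Invariant M = ∀ π y z → M (act π y) (act π z) ≈ M y z

    InT⇒invariant : ∀ {M} → InT M → Respects≐ M × Invariant M
    InT⇒invariant (genA a) = A-resp a , λ π y z → reflexive (≡.cong ⟦_⟧ (does-⇔
      (mk⇔ (λ r i → ≡.trans (≡.sym (rel-act π y z i)) (r i)) (λ r i → ≡.trans (rel-act π y z i) (r i))) (InR? a _ _) (InR? a y z)))
    InT⇒invariant (genE h) = Es-resp , λ π y z → reflexive (≡.cong₂ (λ b b′ → ⟦ b ∧ b′ ⟧)
      (does-⇔ (act-≐ π) (act π y ≟X act π z) (y ≟X z))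
      (does-⇔ (mk⇔ (λ r i → ≡.trans (≡.sym (rel-x-act π y i)) (r i)) (λ r i → ≡.trans (rel-x-act π y i) (r i))) (InR? h x _) (InR? h x y)))
      where
      Es-resp : Respects≐ (Es h)
      Es-resp {y} {y′} {z} {z′} y≐y′ z≐z′ = reflexive (≡.cong₂ (λ b b′ → ⟦ b ∧ b′ ⟧)
        (does-⇔ (mk⇔ (λ e i → ≡.trans (≡.sym (y≐y′ i)) (≡.trans (e i) (z≐z′ i)))
                     (λ e i → ≡.trans (y≐y′ i) (≡.trans (e i) (≡.sym (z≐z′ i))))) (y ≟X z) (y′ ≟X z′))
        (InR?-resp h (λ _ → ≡.refl) y≐y′))
    InT⇒invariant (add M∈T N∈T) with InT⇒invariant M∈T | InT⇒invariant N∈T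
    ... | M-resp , M-inv | N-resp , N-inv =
      (λ y≐ z≐ → +-cong (M-resp y≐ z≐) (N-resp y≐ z≐)) , λ π y z → +-cong (M-inv π y z) (N-inv π y z)
    InT⇒invariant (scal a M∈T) with InT⇒invariant M∈T
    ... | M-resp , M-inv = (λ y≐ z≐ → *-congˡ (M-resp y≐ z≐)) , λ π y z → *-congˡ (M-inv π y z)
    InT⇒invariant (resp M≈N M∈T) with InT⇒invariant M∈T
    ... | M-resp , M-inv = (λ y≐ z≐ → trans (sym (M≈N _ _)) (trans (M-resp y≐ z≐) (M≈N _ _))) ,
                           λ π y z → trans (sym (M≈N _ _)) (trans (M-inv π y z) (M≈N y z))
    InT⇒invariant (mul {M} {N} M∈T N∈T) with InT⇒invariant M∈T | InT⇒invariant N∈T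
    ... | M-resp , M-inv | N-resp , N-inv =
      (λ y≐ z≐ → ∑-cong allX (λ w → *-cong (M-resp y≐ (λ _ → ≡.refl)) (N-resp (λ _ → ≡.refl) z≐))) , λ π y z → begin
        ∑[ w ∈ allX ] (M (act π y) w * N w (act π z))
          ≈⟨ ∑-reindex _≟X_ allX-enumerates (act π) (act⁻¹ π) (act-inverse π) _
               (λ v c v≐c → *-cong (M-resp (λ _ → ≡.refl) v≐c) (N-resp v≐c (λ _ → ≡.refl))) ⟨
        ∑[ w ∈ allX ] (M (act π y) (act π w) * N (act π w) (act π z))
          ≈⟨ ∑-cong allX (λ w → *-cong (M-inv π y w) (N-inv π w z)) ⟩
        ∑[ w ∈ allX ] (M y w * N w z) ∎

    typeOfPair : X → X → Triple n
    typeOfPair y z = tabulate (proj₁ ∘ local) , tabulate (proj₁ ∘ proj₂ ∘ local) , tabulate (proj₂ ∘ proj₂ ∘ local)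
      where
      local : (i : Fin n) → Flags
      local i = typeOf i (rel (y i) (z i))

    ‼-typeOfPair : ∀ y z i → typeOfPair y z ‼ i ≡ typeOf i (rel (y i) (z i))
    ‼-typeOfPair y z i = ≡.cong₂ _,_ (lookup∘tabulate _ i) (≡.cong₂ _,_ (lookup∘tabulate _ i) (lookup∘tabulate _ i))

    typeOfPair-sym : ∀ y z → typeOfPair y z ≡ typeOfPair z y
    typeOfPair-sym y z = ‼-injective λ i →
      ≡.trans (‼-typeOfPair y z i) (≡.trans (≡.cong (typeOf i) (rel-sym i)) (≡.sym (‼-typeOfPair z y i)))
      where
      rel-sym : ∀ i → rel (y i) (z i) ≡ rel (z i) (y i)
      rel-sym i = ≡.trans (rel-blocks (y i) (z i)) (≡.trans (Blk.rel-sym i (y i) (z i)) (≡.sym (rel-blocks (z i) (y i))))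

    shell-triangle : ∀ y z → T (inShell y) → T (inShell z) → ∀ i → T (triangle (Blk.L>2 i) (Blk.M>2 i) (g i) (rel (y i) (z i)) (g i))
    shell-triangle y z y∈ z∈ i = ≡.subst₂ (λ r s → T (triangle (Blk.L>2 i) (Blk.M>2 i) r s (g i)))
      (inShell-coordinates y y∈ i) (≡.sym (rel-blocks (y i) (z i)))
      (≡.subst (λ r → T (triangle (Blk.L>2 i) (Blk.M>2 i) (Blk.rel i (x i) (y i)) (Blk.rel i (y i) (z i)) r))
               (inShell-coordinates z z∈ i) (Blk.rel-triangle i (x i) (y i) (z i)))

    typeOfPair∈𝒰 : ∀ y z → T (inShell y) → T (inShell z) → InU g g (typeOfPair y z)
    typeOfPair∈𝒰 y z y∈ z∈ = InU⇔ (typeOfPair y z) .Equivalence.from λ i →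
      ≡.subst (T ∘ admissible i) (≡.sym (‼-typeOfPair y z i))
        (proj₁ (typeOf-spec (Blk.L>2 i) (Blk.M>2 i) (g i) (rel (y i) (z i)) (shell-triangle y z y∈ z∈ i)))

    BCond?≡⊆₃? : ∀ α → InU g g α → ∀ y z → does (BCond? g g α (relv y z)) ≡ does (typeOfPair y z ⊆₃? α)
    BCond?≡⊆₃? α α∈𝒰 y z = does-⇔ (⇔.trans (BCond⇔ α (relv y z)) (⇔.trans coordinates (⇔.sym (⊆₃⇔ (typeOfPair y z) α))))
                                   (BCond? g g α (relv y z)) (typeOfPair y z ⊆₃? α)
      where
      by-type : ∀ i → allows i (α ‼ i) (rel (y i) (z i)) ≡ (typeOfPair y z ‼ i) ≼ (α ‼ i)
      by-type i = ≡.trans (allows-typeOf (Blk.L>2 i) (Blk.M>2 i) (g i) (α ‼ i) (InU⇔ α .Equivalence.to α∈𝒰 i) (rel (y i) (z i)))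
                          (≡.cong (_≼ (α ‼ i)) (≡.sym (‼-typeOfPair y z i)))
      coordinates : (∀ i → T (allows i (α ‼ i) (rel (y i) (z i)))) ⇔ (∀ i → T ((typeOfPair y z ‼ i) ≼ (α ‼ i)))
      coordinates = mk⇔ (λ h i → ≡.subst T (by-type i) (h i)) (λ h i → ≡.subst T (≡.sym (by-type i)) (h i))

    module Z = Unitriangular commutativeRing _≟₃_ (allTriples n) (InU? g g) _⊆₃?_ ⊆₃-refl height height-<

    linComb-ζ : ∀ cf y z → linComb g cf y z ≈ ⟦ inShell y ∧ inShell z ⟧ * Z.ζ cf (typeOfPair y z)
    linComb-ζ cf y z = begin
      linComb g cf y z
        ≡⟨ ≡.trans (sumM-apply (map term 𝒰) y z) (∑-map term 𝒰 (λ M → M y z)) ⟩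
      ∑[ α ∈ 𝒰 ] (cf α * B g g α y z)
        ≈⟨ ∑-filter (InU? g g) (allTriples n) _ ⟩
      ∑[ α ∈ allTriples n ] (⟦ does (InU? g g α) ⟧ * (cf α * B g g α y z))
        ≈⟨ ∑-cong (allTriples n) (λ α → by-type (InU? g g α)) ⟩
      ∑[ α ∈ allTriples n ] (⟦ inShell y ∧ inShell z ⟧ * (⟦ does (InU? g g α) ∧ does (typeOfPair y z ⊆₃? α) ⟧ * cf α))
        ≈⟨ ∑-*ˡ (allTriples n) _ _ ⟩
      ⟦ inShell y ∧ inShell z ⟧ * Z.ζ cf (typeOfPair y z) ∎
      where
      term : Triple n → Mat
      term α = cf α ·M B g g α
      𝒰 = filter (InU? g g) (allTriples n)
      by-type : ∀ {α} (α∈𝒰? : Dec (InU g g α)) → ⟦ does α∈𝒰? ⟧ * (cf α * B g g α y z) ≈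
                ⟦ inShell y ∧ inShell z ⟧ * (⟦ does α∈𝒰? ∧ does (typeOfPair y z ⊆₃? α) ⟧ * cf α)
      by-type (no  _) = trans (zeroˡ _) (sym (trans (*-congˡ (zeroˡ _)) (zeroʳ _)))
      by-type {α} (yes α∈𝒰) = begin
        1# * (cf α * B g g α y z)
          ≈⟨ *-identityˡ _ ⟩
        cf α * B g g α y z
          ≈⟨ *-congˡ (B-indicator α y z) ⟩
        cf α * (⟦ inShell y ∧ inShell z ⟧ * ⟦ does (BCond? g g α (relv y z)) ⟧)
          ≈⟨ *-CS.x∙yz≈y∙zx _ _ _ ⟩
        ⟦ inShell y ∧ inShell z ⟧ * (⟦ does (BCond? g g α (relv y z)) ⟧ * cf α)
          ≡⟨ ≡.cong (λ b → _ * (⟦ b ⟧ * cf α)) (BCond?≡⊆₃? α α∈𝒰 y z) ⟩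
        ⟦ inShell y ∧ inShell z ⟧ * (⟦ does (typeOfPair y z ⊆₃? α) ⟧ * cf α) ∎

    canonicalY canonicalZ : Triple n → X
    canonicalY t i = proj₁ (Blk.pairFor i (x i) (g i) (realise i (t ‼ i)))
    canonicalZ t i = proj₂ (Blk.pairFor i (x i) (g i) (realise i (t ‼ i)))

    module _ (2≤ls : ∀ i → 2 ℕ.≤ ls i) (2≤ms : ∀ i → 2 ℕ.≤ ms i) where

      canonical-rel : ∀ t i → T (triangle (Blk.L>2 i) (Blk.M>2 i) (g i) (realise i (t ‼ i)) (g i)) →
                      Blk.rel i (x i) (canonicalY t i) ≡ g i × Blk.rel i (x i) (canonicalZ t i) ≡ g i ×
                      Blk.rel i (canonicalY t i) (canonicalZ t i) ≡ realise i (t ‼ i)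
      canonical-rel t i = Blk.pairFor-rel i (2≤ls i) (2≤ms i) (x i) (g i) (realise i (t ‼ i))

      module _ (t : Triple n) (t∈𝒰 : InU g g t) where

        realised : ∀ i → typeOf i (realise i (t ‼ i)) ≡ t ‼ i × T (triangle (Blk.L>2 i) (Blk.M>2 i) (g i) (realise i (t ‼ i)) (g i))
        realised i = realise-spec (Blk.L>2 i) (Blk.M>2 i) (g i) (t ‼ i) (InU⇔ t .Equivalence.to t∈𝒰 i)

        canonical-inShell : T (inShell (canonicalY t) ∧ inShell (canonicalZ t))
        canonical-inShell = Bool.T-∧ .Equivalence.from
          ( T-does (InR? g x (canonicalY t)) .Equivalence.from (λ i →
              ≡.trans (rel-blocks (x i) (canonicalY t i)) (proj₁ (canonical-rel t i (proj₂ (realised i)))))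
          , T-does (InR? g x (canonicalZ t)) .Equivalence.from (λ i →
              ≡.trans (rel-blocks (x i) (canonicalZ t i)) (proj₁ (proj₂ (canonical-rel t i (proj₂ (realised i)))))))

        typeOfPair-canonical : typeOfPair (canonicalY t) (canonicalZ t) ≡ t
        typeOfPair-canonical = ‼-injective λ i → ≡.trans (‼-typeOfPair (canonicalY t) (canonicalZ t) i)
          (≡.trans (≡.cong (typeOf i) (≡.trans (rel-blocks (canonicalY t i) (canonicalZ t i))
                                               (proj₂ (proj₂ (canonical-rel t i (proj₂ (realised i)))))))
                   (proj₁ (realised i)))

      homogeneous : ∀ y z → T (inShell y) → T (inShell z) → Σ[ π ∈ Stabiliser ]
                    act π y ≐ canonicalY (typeOfPair y z) × act π z ≐ canonicalZ (typeOfPair y z)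
      homogeneous y z y∈ z∈ = (λ i → proj₁ (move i) , proj₁ (proj₂ (move i))) ,
                                  (λ i → proj₁ (proj₂ (proj₂ (move i)))) , (λ i → proj₂ (proj₂ (proj₂ (move i))))
        where
        t = typeOfPair y z
        realise-rel : ∀ i → realise i (t ‼ i) ≡ rel (y i) (z i)
        realise-rel i = ≡.trans (≡.cong (realise i) (‼-typeOfPair y z i))
                                (proj₂ (typeOf-spec (Blk.L>2 i) (Blk.M>2 i) (g i) (rel (y i) (z i)) (shell-triangle y z y∈ z∈ i)))
        pair-rel : ∀ i → _
        pair-rel i = canonical-rel t i (≡.subst (λ r → T (triangle (Blk.L>2 i) (Blk.M>2 i) (g i) r (g i))) (≡.sym (realise-rel i))
                                                (shell-triangle y z y∈ z∈ i))
        move : ∀ i → _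
        move i = Blk.move₂ i (x i) (y i) (z i) (canonicalY t i) (canonicalZ t i)
          (≡.trans (inShell-coordinates y y∈ i) (≡.sym (proj₁ (pair-rel i))))
          (≡.trans (inShell-coordinates z z∈ i) (≡.sym (proj₁ (proj₂ (pair-rel i)))))
          (≡.trans (≡.sym (rel-blocks (y i) (z i))) (≡.trans (≡.sym (realise-rel i)) (≡.sym (proj₂ (proj₂ (pair-rel i))))))

      InETE-by-type : ∀ N → InETE g N → ∀ y z →
        N y z ≈ ⟦ inShell y ∧ inShell z ⟧ * N (canonicalY (typeOfPair y z)) (canonicalZ (typeOfPair y z))
      InETE-by-type N (M , M∈T , N≈EME) y z = begin
        N y z                               ≈⟨ N≈EME y z ⟩
        ((Es g *M M) *M Es g) y z           ≈⟨ Es-sandwich M M-resp y z ⟩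
        ⟦ inShell y ∧ inShell z ⟧ * M y z   ≈⟨ ⟦⟧-*-cong (inShell y ∧ inShell z) representative ⟩
        ⟦ inShell y ∧ inShell z ⟧ * N Y Z   ∎
        where
        t = typeOfPair y z
        Y = canonicalY t
        Z = canonicalZ t
        M-resp = proj₁ (InT⇒invariant M∈T)
        M-inv  = proj₂ (InT⇒invariant M∈T)
        representative : T (inShell y ∧ inShell z) → M y z ≈ N Y Z
        representative y∈z∈ = begin
          M y z                              ≈⟨ M-inv π y z ⟨
          M (act π y) (act π z)              ≈⟨ M-resp (proj₁ (proj₂ moved)) (proj₂ (proj₂ moved)) ⟩
          M Y Z                              ≈⟨ *-identityˡ (M Y Z) ⟨
          1# * M Y Z                         ≈⟨ *-congʳ (⟦⟧-T {inShell Y ∧ inShell Z} (canonical-inShell t (typeOfPair∈𝒰 y z y∈ z∈))) ⟨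
          ⟦ inShell Y ∧ inShell Z ⟧ * M Y Z  ≈⟨ Es-sandwich M M-resp Y Z ⟨
          ((Es g *M M) *M Es g) Y Z          ≈⟨ N≈EME Y Z ⟨
          N Y Z                              ∎
          where
          y∈ = proj₁ (Bool.T-∧ .Equivalence.to y∈z∈)
          z∈ = proj₂ (Bool.T-∧ .Equivalence.to y∈z∈)
          moved = homogeneous y z y∈ z∈
          π = proj₁ moved

      spanned : ∀ N → InETE g N → Σ[ cf ∈ (Triple n → Carrier) ] N ≈M linComb g cf
      spanned N N∈ with Z.ζ-surjective allTriples-enumerates (λ t → N (canonicalY t) (canonicalZ t))
      ... | cf , solves = cf , λ y z → begin
        N y z
          ≈⟨ InETE-by-type N N∈ y z ⟩
        ⟦ inShell y ∧ inShell z ⟧ * N (canonicalY (typeOfPair y z)) (canonicalZ (typeOfPair y z))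
          ≈⟨ ⟦⟧-*-cong (inShell y ∧ inShell z) (λ y∈z∈ → sym (solves (typeOfPair y z)
               (typeOfPair∈𝒰 y z (proj₁ (Bool.T-∧ .Equivalence.to y∈z∈)) (proj₂ (Bool.T-∧ .Equivalence.to y∈z∈))))) ⟩
        ⟦ inShell y ∧ inShell z ⟧ * Z.ζ cf (typeOfPair y z)
          ≈⟨ linComb-ζ cf y z ⟨
        linComb g cf y z ∎

      independent : ∀ cf → linComb g cf ≈M OM → ∀ α → InU g g α → cf α ≈ 0#
      independent cf cf≈0 = Z.ζ-injective allTriples-enumerates cf λ t t∈𝒰 → begin
        Z.ζ cf t                                      ≡⟨ ≡.cong (Z.ζ cf) (typeOfPair-canonical t t∈𝒰) ⟨
        Z.ζ cf (typeOfPair (canonicalY t) (canonicalZ t))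
                                                      ≈⟨ *-identityˡ _ ⟨
        1# * Z.ζ cf (typeOfPair (canonicalY t) (canonicalZ t))
                                                      ≈⟨ *-congʳ (⟦⟧-T {inShell (canonicalY t) ∧ inShell (canonicalZ t)} (canonical-inShell t t∈𝒰)) ⟨
        ⟦ inShell (canonicalY t) ∧ inShell (canonicalZ t) ⟧ * Z.ζ cf (typeOfPair (canonicalY t) (canonicalZ t))
                                                      ≈⟨ linComb-ζ cf (canonicalY t) (canonicalZ t) ⟨
        linComb g cf (canonicalY t) (canonicalZ t)    ≈⟨ cf≈0 (canonicalY t) (canonicalZ t) ⟩
        0#                                            ∎

      InETE-symmetric : ∀ N → InETE g N → ∀ y z → N y z ≈ N z y
      InETE-symmetric N N∈ y z = trans (InETE-by-type N N∈ y z)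
        (trans (reflexive (≡.cong₂ (λ b t → ⟦ b ⟧ * N (canonicalY t) (canonicalZ t)) (Bool.∧-comm (inShell y) (inShell z)) (typeOfPair-sym y z)))
               (sym (InETE-by-type N N∈ z y)))

      InETE-commute : ∀ M N → InETE g M → InETE g N → (M *M N) ≈M (N *M M)
      InETE-commute M N M∈ N∈ y z = begin
        ∑[ w ∈ allX ] (M y w * N w z)
          ≈⟨ ∑-cong allX (λ w → trans (*-cong (InETE-symmetric M M∈ y w) (InETE-symmetric N N∈ w z)) (*-comm _ _)) ⟩
        ∑[ w ∈ allX ] (N z w * M w y)
          ≈⟨ InETE-symmetric (N *M M) (InETE-* N M N∈ M∈) z y ⟩
        (N *M M) y z ∎

lemma4p6 : ∀ {c ℓ : Level} (F : Field c ℓ) (n : ℕ) → 1 ≤ n → (ls ms : Fin n → ℕ) →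
    (∀ i → 2 ≤ ls i) → (∀ i → 2 ≤ ms i) →
    let open Field F in
    let open Setup F n ls ms in
    (x : X) (g : E n) →
    let open Based x in
    -- B_{g,g,τ} B_{g,g,σ} = k_{τ∩σ} B_{g,g,τ∪σ}
    (∀ τ σ → InU g g τ → InU g g σ →
       (B g g τ *M B g g σ) ≈M (ι (k (τ ∩₃ σ)) ·M B g g (τ ∪₃ σ)))
    -- E*_g 𝕋 E*_g is an F-subalgebra of 𝕋
    × (∀ N → InETE g N → InT N)
    × (∀ M N → InETE g M → InETE g N → InETE g (M +M N))
    × (∀ M N → InETE g M → InETE g N → InETE g (M *M N))
    × (∀ a M → InETE g M → InETE g (a ·M M))
    -- which is commutative
    × (∀ M N → InETE g M → InETE g N → (M *M N) ≈M (N *M M))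
    -- and has basis { B_{g,g,α} : α ∈ 𝒰_{g,g} }
    × (∀ α → InU g g α → InETE g (B g g α))
    × (∀ N → InETE g N → Σ (Triple n → Carrier) λ cf → N ≈M linComb g cf)
    × (∀ cf → linComb g cf ≈M OM → ∀ α → InU g g α → cf α ≈ 0#)
lemma4p6 F n _ ls ms 2≤ls 2≤ms x g =
  B-*-B , InETE⇒InT , InETE-+ , InETE-* , InETE-· , InETE-commute 2≤ls 2≤ms ,
  (λ α _ → B∈ETE α) , spanned 2≤ls 2≤ms , independent 2≤ls 2≤ms
  where
  open Scheme F n ls ms
  open Closure x g
  open Shell x g
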